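{- $$\sum_{n\ge0}F_n(x)\frac{z^n}{n!}=\sqrt{T\!\left(\frac{2x}{1+x^2},(1+x^2)z\right)}.$$
   Context: A Stirling permutation of order $n$ is a permutation $\sigma$ of the multiset $\{1,1,\dots,n,n\}$ such that for each $i$ all entries between the two occurrences of $i$ are larger than $i$; $\mathcal{Q}_n$ is their set. $\Phi$ maps $\sigma\in\mathcal{Q}_n$ to the permutation of $[2n]$ obtained by replacing the first occurrence of each $j$ by $2j$ and the second by $2j-1$; $\Phi(\mathcal{Q}_n)$ is the set of dual Stirling permutations. ${\rm altrun}(\pi)$ is the number of alternating runs (maximal consecutive increasing or decreasing subsequences) of $\pi$. $F_n(x)=\sum_{\pi\in\Phi(\mathcal{Q}_n)}x^{{\rm altrun}(\pi)}$ for $n\ge1$, $F_0(x)=1$. $T(x,z)=\sum_{n\ge0}T_n(x)z^n/n!$ with $T_0=1$ and $T_n(x)=\sum_{\pi\in\mathfrak{S}_n}x^{{\rm udrun}(\pi)}$, where ${\rm udrun}(\pi)$ is the number of alternating runs of the word $0\pi(1)\cdots\pi(n)$; the square root is the formal power series in $z$ with constant term $1$. -}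

module Defs where

open import Data.Nat using (ℕ; zero; suc; _+_; _*_; _∸_; _≡ᵇ_; _<ᵇ_)
open import Data.Nat.Combinatorics using (_C_)
open import Data.Bool using (Bool; true; false; if_then_else_; _∧_; _∨_; not)
open import Data.List using (List; []; _∷_; map; concatMap; filter; length; foldr; upTo; takeWhile; dropWhile; drop)
open import Data.Bool.ListAction using (all; any)
open import Data.Bool.Properties using (T?)
open import Data.Bool using (T)

words : ℕ → ℕ → List (List ℕ)
words zero    m = [] ∷ []
words (suc l) m = concatMap (λ w → map (λ a → a ∷ w) (map suc (upTo m))) (words l m)

oneTo : ℕ → List ℕ
oneTo n = map suc (upTo n)

occ : ℕ → List ℕ → ℕ
occ v w = length (filter (λ a → T? (v ≡ᵇ a)) w)

countB : {A : Set} → (A → Bool) → List A → ℕ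
countB p xs = length (filter (λ a → T? (p a)) xs)

between : ℕ → List ℕ → List ℕ
between i w = takeWhile (λ a → T? (not (i ≡ᵇ a))) (drop 1 (dropWhile (λ a → T? (not (i ≡ᵇ a))) w))

isStirling : ℕ → List ℕ → Bool
isStirling n w = all (λ i → (occ i w ≡ᵇ 2) ∧ all (λ a → i <ᵇ a) (between i w)) (oneTo n)

elemB : ℕ → List ℕ → Bool
elemB v xs = any (λ a → v ≡ᵇ a) xs

phiGo : List ℕ → List ℕ → List ℕ
phiGo seen []      = []
phiGo seen (j ∷ w) =
  if elemB j seen then (2 * j ∸ 1) ∷ phiGo seen w
                  else (2 * j) ∷ phiGo (j ∷ seen) w

Φ : List ℕ → List ℕ
Φ = phiGo []

-- Alternating runs of a word with distinct entries:
-- maximal monotone runs are separated exactly at peaks and valleys, so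
-- altrun = 1 + #(peaks and valleys) for length ≥ 2, 1 for length 1, 0 for [].

turnAt : ℕ → ℕ → ℕ → Bool
turnAt a b c = ((a <ᵇ b) ∧ (c <ᵇ b)) ∨ ((b <ᵇ a) ∧ (b <ᵇ c))

turns : List ℕ → ℕ
turns (a ∷ b ∷ c ∷ rest) = (if turnAt a b c then 1 else 0) + turns (b ∷ c ∷ rest)
turns _ = 0

altrun : List ℕ → ℕ
altrun []          = 0
altrun (a ∷ [])    = 1
altrun (a ∷ b ∷ w) = 1 + turns (a ∷ b ∷ w)

udrun : List ℕ → ℕ
udrun w = altrun (0 ∷ w)

isPerm : ℕ → List ℕ → Bool
isPerm n w = all (λ i → occ i w ≡ᵇ 1) (oneTo n)

-- Polynomials in x with natural-number coefficients: coefficient lists,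
-- lowest degree first; compared coefficientwise via `coeff`.

Poly : Set
Poly = List ℕ

coeff : Poly → ℕ → ℕ
coeff []      d       = 0
coeff (a ∷ p) zero    = a
coeff (a ∷ p) (suc d) = coeff p d

_+P_ : Poly → Poly → Poly
[]      +P q       = q
(a ∷ p) +P []      = a ∷ p
(a ∷ p) +P (b ∷ q) = (a + b) ∷ (p +P q)

scaleP : ℕ → Poly → Poly
scaleP c p = map (c *_) p

_*P_ : Poly → Poly → Poly
[]      *P q = []
(a ∷ p) *P q = scaleP a q +P (0 ∷ (p *P q))

powP : Poly → ℕ → Poly
powP p zero    = 1 ∷ []
powP p (suc k) = p *P powP p k

sumP : List Poly → Poly
sumP = foldr _+P_ []

-- F_n(x) = Σ_{π ∈ Φ(Q_n)} x^{altrun π}  (F_0 = 1); altrun ≤ 2n.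

Fpoly : ℕ → Poly
Fpoly zero = 1 ∷ []
Fpoly (suc m) = map (λ k → countB (λ w → isStirling n w ∧ (altrun (Φ w) ≡ᵇ k)) (words (2 * n) n)) (upTo (suc (2 * n)))
  where n = suc m

-- T_n(x) = Σ_{π ∈ S_n} x^{udrun π}  (T_0 = 1); udrun ≤ n.
Tpoly : ℕ → Poly
Tpoly zero = 1 ∷ []
Tpoly (suc m) = map (λ k → countB (λ w → isPerm n w ∧ (udrun w ≡ᵇ k)) (words n n)) (upTo (suc n))
  where n = suc m

-- n! [z^n] (Σ F_k z^k/k!)^2 = Σ_k C(n,k) F_k F_{n-k}
lhsCoeff : ℕ → Poly
lhsCoeff n = sumP (map (λ k → scaleP (n C k) (Fpoly k *P Fpoly (n ∸ k))) (upTo (suc n)))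

-- n! [z^n] T(2x/(1+x^2), (1+x^2) z) = (1+x^2)^n T_n(2x/(1+x^2))
--   = Σ_j [x^j]T_n · (2x)^j (1+x^2)^{n-j}   (deg T_n ≤ n)
rhsCoeff : ℕ → Poly
rhsCoeff n = sumP (map (λ j → scaleP (coeff (Tpoly n) j)
                                 (powP (0 ∷ 2 ∷ []) j *P powP (1 ∷ 0 ∷ 1 ∷ []) (n ∸ j)))
                       (upTo (suc n)))

{-# OPTIONS --safe #-}
module Submission where

open import Defs
open import Data.Nat using (ℕ)
open import Relation.Binary.PropositionalEquality using (_≡_)

-- Let Λ c C P = x (c + C x) P + x (1 − x²) P′. Inserting the block (2n + 2, 2n + 1) into the
-- 2n + 1 gaps of a dual Stirling permutation with r alternating runs yields r permutations with
-- r runs, one with r + 1 runs and 2n − r with r + 2 runs, so F_{n+1} = Λ 1 (2n) F_n; inserting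
-- n + 1 into the gaps after the leading 0 of 0 π(1) … π(n) likewise gives T_{n+1} = Λ 1 n T_n.
-- Both counts are done on direction sequences, since the number of runs of a word without equal
-- neighbours is one more than the number of changes of direction.
--
-- Λ satisfies the Leibniz rule (Λ c C P) Q + P (Λ c′ C′ Q) = Λ (c + c′) (C + C′) (P Q), so by
-- Pascal's rule the coefficients L_n = Σ_k C(n,k) F_k F_{n−k} of the squared left-hand side obey
-- L_{n+1} = Λ 2 (2n) L_n. The right-hand side has coefficients R_n = Σ_j [xʲ]T_n (2x)ʲ (1 + x²)^{n−j},
-- and Λ 2 (2(j + k)) maps (2x)ʲ (1 + x²)ᵏ to
--   j (2x)ʲ (1 + x²)^{k+1} + (2x)^{j+1} (1 + x²)ᵏ + k (2x)^{j+2} (1 + x²)^{k−1},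
-- which turns the recurrence of the T_n into R_{n+1} = Λ 2 (2n) R_n. Both sides start at 1.

module PowerSeries where

  open import Data.Nat using (ℕ; zero; suc; _∸_; _<_; _≡ᵇ_; z≤n; s≤s)
  import Data.Nat as ℕ
  import Data.Nat.Properties as ℕ
  open import Data.Integer using (ℤ; +_; -_; 0ℤ; 1ℤ; _+_; _-_; _*_)
  import Data.Integer.Properties as ℤ
  open import Data.Integer.Tactic.RingSolver using (solve-∀)
  open import Data.Bool using (if_then_else_)
  open import Function using (_∘_)
  open import Relation.Binary.PropositionalEquality
  open ≡-Reasoning

  -- A power series over ℤ is its coefficient sequence: shift is multiplication by x,
  -- θ = x d/dx, ι r = xʳ and ⋆ is the product.
  Seq : Set
  Seq = ℕ → ℤ

  infixl 6 _⊕_ _⊖_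
  infixl 7 _·_ _⋆_

  _⊕_ _⊖_ : Seq → Seq → Seq
  (f ⊕ g) m = f m + g m
  (f ⊖ g) m = f m - g m

  _·_ : ℤ → Seq → Seq
  (a · f) m = a * f m

  shift : Seq → Seq
  shift f zero    = 0ℤ
  shift f (suc m) = f m

  shift² : Seq → Seq
  shift² f = shift (shift f)

  θ : Seq → Seq
  θ f m = + m * f m

  ι : ℕ → Seq
  ι r m = if r ≡ᵇ m then 1ℤ else 0ℤ

  sumBelow : ℕ → (ℕ → ℤ) → ℤ
  sumBelow zero    f = 0ℤ
  sumBelow (suc n) f = f 0 + sumBelow n (f ∘ suc)

  infixl 10 sumBelow
  syntax sumBelow n (λ i → e) = ∑[ i < n ] e

  _⋆_ : Seq → Seq → Seq
  (f ⋆ g) m = ∑[ i < suc m ] (f i * g (m ∸ i))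

  ∑-cong : ∀ n {f g : ℕ → ℤ} → (∀ i → i < n → f i ≡ g i) → ∑[ i < n ] f i ≡ ∑[ i < n ] g i
  ∑-cong zero    eq = refl
  ∑-cong (suc n) eq = cong₂ _+_ (eq 0 (s≤s z≤n)) (∑-cong n (λ i i<n → eq (suc i) (s≤s i<n)))

  ∑-distrib-+ : ∀ n (f g : ℕ → ℤ) → ∑[ i < n ] (f i + g i) ≡ ∑[ i < n ] f i + ∑[ i < n ] g i
  ∑-distrib-+ zero    f g = refl
  ∑-distrib-+ (suc n) f g = trans (cong (_+_ (f 0 + g 0)) (∑-distrib-+ n (f ∘ suc) (g ∘ suc))) (swap (f 0) (g 0) _ _)
    where
    swap : ∀ a b c d → a + b + (c + d) ≡ a + c + (b + d)
    swap = solve-∀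

  ∑-distrib-+₃ : ∀ n (p q r : ℕ → ℤ) →
    ∑[ i < n ] (p i + q i + r i) ≡ ∑[ i < n ] p i + ∑[ i < n ] q i + ∑[ i < n ] r i
  ∑-distrib-+₃ n p q r = trans (∑-distrib-+ n (λ i → p i + q i) r) (cong (_+ ∑[ i < n ] r i) (∑-distrib-+ n p q))

  ∑-*ˡ : ∀ n a (f : ℕ → ℤ) → ∑[ i < n ] (a * f i) ≡ a * ∑[ i < n ] f i
  ∑-*ˡ zero    a f = sym (ℤ.*-zeroʳ a)
  ∑-*ˡ (suc n) a f = trans (cong (_+_ (a * f 0)) (∑-*ˡ n a (f ∘ suc))) (sym (ℤ.*-distribˡ-+ a (f 0) _))

  ∑-zero : ∀ n → ∑[ i < n ] 0ℤ ≡ 0ℤ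
  ∑-zero zero    = refl
  ∑-zero (suc n) = trans (ℤ.+-identityˡ _) (∑-zero n)

  ∑-last : ∀ n (f : ℕ → ℤ) → ∑[ i < suc n ] f i ≡ ∑[ i < n ] f i + f n
  ∑-last zero    f = trans (ℤ.+-identityʳ (f 0)) (sym (ℤ.+-identityˡ (f 0)))
  ∑-last (suc n) f = trans (cong (_+_ (f 0)) (∑-last n (f ∘ suc))) (sym (ℤ.+-assoc (f 0) _ _))

  ∑-combination : ∀ n c C (p q r s : ℕ → ℤ) →
    ∑[ i < n ] (p i + c * q i + C * r i - s i) ≡
    ∑[ i < n ] p i + c * ∑[ i < n ] q i + C * ∑[ i < n ] r i - ∑[ i < n ] s i
  ∑-combination zero    c C p q r s = zeros c C
    where
    zeros : ∀ c C → 0ℤ ≡ 0ℤ + c * 0ℤ + C * 0ℤ - 0ℤ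
    zeros = solve-∀
  ∑-combination (suc n) c C p q r s = trans
    (cong (_+_ (p 0 + c * q 0 + C * r 0 - s 0)) (∑-combination n c C (p ∘ suc) (q ∘ suc) (r ∘ suc) (s ∘ suc)))
    (regroup (p 0) (q 0) (r 0) (s 0) (sumBelow n (p ∘ suc)) (sumBelow n (q ∘ suc))
                                       (sumBelow n (r ∘ suc)) (sumBelow n (s ∘ suc)) c C)
    where
    regroup : ∀ p q r s P Q R S c C →
      p + c * q + C * r - s + (P + c * Q + C * R - S) ≡ p + P + c * (q + Q) + C * (r + R) - (s + S)
    regroup = solve-∀

  -- The dropped term shift u 0 * v 0 is 0ℤ * v 0, which computes to 0ℤ.
  ∑-shift : ∀ n (u v : ℕ → ℤ) → ∑[ j < suc n ] (shift u j * v j) ≡ ∑[ j < n ] (u j * v (suc j))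
  ∑-shift n u v = ℤ.+-identityˡ _

  shift-cong : ∀ {f g} → f ≗ g → shift f ≗ shift g
  shift-cong eq zero    = refl
  shift-cong eq (suc m) = eq m

  shift²-cong : ∀ {f g} → f ≗ g → shift² f ≗ shift² g
  shift²-cong eq = shift-cong (shift-cong eq)

  shift-⊕ : ∀ f g → shift (f ⊕ g) ≗ shift f ⊕ shift g
  shift-⊕ f g zero    = refl
  shift-⊕ f g (suc m) = refl

  shift-⊖ : ∀ f g → shift (f ⊖ g) ≗ shift f ⊖ shift g
  shift-⊖ f g zero    = refl
  shift-⊖ f g (suc m) = refl

  shift-· : ∀ a f → shift (a · f) ≗ a · shift f
  shift-· a f zero    = sym (ℤ.*-zeroʳ a)
  shift-· a f (suc m) = refl

  shift²-⊕ : ∀ f g → shift² (f ⊕ g) ≗ shift² f ⊕ shift² g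
  shift²-⊕ f g m = trans (shift-cong (shift-⊕ f g) m) (shift-⊕ (shift f) (shift g) m)

  shift²-· : ∀ a f → shift² (a · f) ≗ a · shift² f
  shift²-· a f m = trans (shift-cong (shift-· a f) m) (shift-· a (shift f) m)

  θ-⊕ : ∀ f g → θ (f ⊕ g) ≗ θ f ⊕ θ g
  θ-⊕ f g m = ℤ.*-distribˡ-+ (+ m) (f m) (g m)

  θ-· : ∀ a f → θ (a · f) ≗ a · θ f
  θ-· a f m = swap (+ m) a (f m)
    where
    swap : ∀ k a x → k * (a * x) ≡ a * (k * x)
    swap = solve-∀

  θ-shift : ∀ f → θ (shift f) ≗ shift (θ f) ⊕ shift f
  θ-shift f zero    = refl
  θ-shift f (suc m) = trans (cong (_* f m) (ℤ.pos-+ 1 m)) (expand (+ m) (f m))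
    where
    expand : ∀ k x → (1ℤ + k) * x ≡ k * x + x
    expand = solve-∀

  θ-shift² : ∀ f → θ (shift² f) ≗ shift² (θ f) ⊕ + 2 · shift² f
  θ-shift² f m = begin
    θ (shift² f) m                                   ≡⟨ θ-shift (shift f) m ⟩
    shift (θ (shift f)) m + shift² f m               ≡⟨ cong (_+ shift² f m) (shift-cong (θ-shift f) m) ⟩
    shift (shift (θ f) ⊕ shift f) m + shift² f m     ≡⟨ cong (_+ shift² f m) (shift-⊕ (shift (θ f)) (shift f) m) ⟩
    shift² (θ f) m + shift² f m + shift² f m         ≡⟨ double (shift² (θ f) m) (shift² f m) ⟩
    shift² (θ f) m + + 2 * shift² f m                ∎
    where
    double : ∀ a b → a + b + b ≡ a + + 2 * b
    double = solve-∀

  *-ι : ∀ (w : ℕ → ℤ) r m → w m * ι r m ≡ w r * ι r m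
  *-ι w zero    zero    = refl
  *-ι w zero    (suc m) = trans (ℤ.*-zeroʳ (w (suc m))) (sym (ℤ.*-zeroʳ (w 0)))
  *-ι w (suc r) zero    = trans (ℤ.*-zeroʳ (w 0)) (sym (ℤ.*-zeroʳ (w (suc r))))
  *-ι w (suc r) (suc m) = *-ι (w ∘ suc) r m

  θ-ι : ∀ r → θ (ι r) ≗ + r · ι r
  θ-ι r = *-ι +_ r

  shift-ι : ∀ r → shift (ι r) ≗ ι (suc r)
  shift-ι r zero    = refl
  shift-ι r (suc m) = refl

  ⋆-cong : ∀ {f f′ g g′} → f ≗ f′ → g ≗ g′ → f ⋆ g ≗ f′ ⋆ g′
  ⋆-cong eqf eqg m = ∑-cong (suc m) (λ i _ → cong₂ _*_ (eqf i) (eqg (m ∸ i)))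

  ⋆-unfold : ∀ f g → f ⋆ g ≗ f 0 · g ⊕ shift ((f ∘ suc) ⋆ g)
  ⋆-unfold f g zero    = refl
  ⋆-unfold f g (suc m) = refl

  ⊕-⋆ : ∀ f f′ g → (f ⊕ f′) ⋆ g ≗ f ⋆ g ⊕ f′ ⋆ g
  ⊕-⋆ f f′ g m = trans (∑-cong (suc m) (λ i _ → ℤ.*-distribʳ-+ (g (m ∸ i)) (f i) (f′ i)))
                       (∑-distrib-+ (suc m) (λ i → f i * g (m ∸ i)) (λ i → f′ i * g (m ∸ i)))

  ·-⋆ : ∀ a f g → (a · f) ⋆ g ≗ a · (f ⋆ g)
  ·-⋆ a f g m = trans (∑-cong (suc m) (λ i _ → ℤ.*-assoc a (f i) (g (m ∸ i))))
                      (∑-*ˡ (suc m) a (λ i → f i * g (m ∸ i)))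

  shift-⋆ : ∀ f g → shift f ⋆ g ≗ shift (f ⋆ g)
  shift-⋆ f g zero    = refl
  shift-⋆ f g (suc m) = ℤ.+-identityˡ ((f ⋆ g) m)

  ⋆-shift : ∀ f g → f ⋆ shift g ≗ shift (f ⋆ g)
  ⋆-shift f g zero    = trans (ℤ.+-identityʳ (f 0 * 0ℤ)) (ℤ.*-zeroʳ (f 0))
  ⋆-shift f g (suc m) = begin
    ∑[ i < suc (suc m) ] (f i * shift g (suc m ∸ i))
      ≡⟨ ∑-last (suc m) (λ i → f i * shift g (suc m ∸ i)) ⟩
    ∑[ i < suc m ] (f i * shift g (suc m ∸ i)) + f (suc m) * shift g (m ∸ m)
      ≡⟨ cong₂ _+_ (∑-cong (suc m) (λ i i<1+m →
                      cong (λ k → f i * shift g k) (ℕ.+-∸-assoc 1 (ℕ.≤-pred i<1+m))))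
                   (trans (cong (λ k → f (suc m) * shift g k) (ℕ.n∸n≡0 m)) (ℤ.*-zeroʳ (f (suc m)))) ⟩
    (f ⋆ g) m + 0ℤ
      ≡⟨ ℤ.+-identityʳ _ ⟩
    (f ⋆ g) m ∎

  shift²-⋆ : ∀ f g → shift² f ⋆ g ≗ shift² (f ⋆ g)
  shift²-⋆ f g m = trans (shift-⋆ (shift f) g m) (shift-cong (shift-⋆ f g) m)

  ⋆-shift² : ∀ f g → f ⋆ shift² g ≗ shift² (f ⋆ g)
  ⋆-shift² f g m = trans (⋆-shift f (shift g) m) (shift-cong (⋆-shift f g) m)

  θ-⋆ : ∀ f g → θ (f ⋆ g) ≗ θ f ⋆ g ⊕ f ⋆ θ g
  θ-⋆ f g m = begin
    + m * (f ⋆ g) m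
      ≡⟨ ∑-*ˡ (suc m) (+ m) (λ i → f i * g (m ∸ i)) ⟨
    ∑[ i < suc m ] (+ m * (f i * g (m ∸ i)))
      ≡⟨ ∑-cong (suc m) (λ i i<1+m → split i (ℕ.≤-pred i<1+m)) ⟩
    ∑[ i < suc m ] (θ f i * g (m ∸ i) + f i * θ g (m ∸ i))
      ≡⟨ ∑-distrib-+ (suc m) (λ i → θ f i * g (m ∸ i)) (λ i → f i * θ g (m ∸ i)) ⟩
    (θ f ⋆ g) m + (f ⋆ θ g) m ∎
    where
    expand : ∀ i j x y → (i + j) * (x * y) ≡ i * x * y + x * (j * y)
    expand = solve-∀
    split : ∀ i → i ℕ.≤ m → + m * (f i * g (m ∸ i)) ≡ θ f i * g (m ∸ i) + f i * θ g (m ∸ i)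
    split i i≤m = begin
      + m * (f i * g (m ∸ i))               ≡⟨ cong (λ k → + k * (f i * g (m ∸ i))) (ℕ.m+[n∸m]≡n i≤m) ⟨
      + (i ℕ.+ (m ∸ i)) * (f i * g (m ∸ i)) ≡⟨ cong (_* (f i * g (m ∸ i))) (ℤ.pos-+ i (m ∸ i)) ⟩
      (+ i + + (m ∸ i)) * (f i * g (m ∸ i)) ≡⟨ expand (+ i) (+ (m ∸ i)) (f i) (g (m ∸ i)) ⟩
      θ f i * g (m ∸ i) + f i * θ g (m ∸ i) ∎

  ι₀-⋆ : ∀ g → ι 0 ⋆ g ≗ g
  ι₀-⋆ g m = begin
    1ℤ * g m + ∑[ i < m ] (0ℤ * g (m ∸ suc i)) ≡⟨ cong₂ _+_ (ℤ.*-identityˡ (g m)) (trans vanish (∑-zero m)) ⟩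
    g m + 0ℤ                                  ≡⟨ ℤ.+-identityʳ (g m) ⟩
    g m                                       ∎
    where
    vanish : ∑[ i < m ] (0ℤ * g (m ∸ suc i)) ≡ ∑[ i < m ] 0ℤ
    vanish = ∑-cong m (λ i _ → ℤ.*-zeroˡ (g (m ∸ suc i)))

  Λ : ℤ → ℤ → Seq → Seq
  Λ c C f = θ f ⊕ c · shift f ⊕ C · shift² f ⊖ shift² (θ f)

  Λ-expand : ∀ c C f {m a b d e} → θ f m ≡ a → shift f m ≡ b → shift² f m ≡ d → shift² (θ f) m ≡ e →
           Λ c C f m ≡ a + c * b + C * d - e
  Λ-expand c C f refl refl refl refl = refl

  Λ-cong : ∀ c C {f g} → f ≗ g → Λ c C f ≗ Λ c C g
  Λ-cong c C {f} eq m =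
    Λ-expand c C f (cong (+ m *_) (eq m)) (shift-cong eq m) (shift²-cong eq m) (shift²-cong (λ k → cong (+ k *_) (eq k)) m)

  Λ-zero : ∀ c C → Λ c C (λ _ → 0ℤ) ≗ λ _ → 0ℤ
  Λ-zero c C m = trans (Λ-expand c C (λ _ → 0ℤ) {m} (ℤ.*-zeroʳ (+ m)) (shift-zero m) (shift²-zero m)
                               (trans (shift²-cong (λ k → ℤ.*-zeroʳ (+ k)) m) (shift²-zero m)))
                       (vanish c C)
    where
    shift-zero : shift (λ _ → 0ℤ) ≗ λ _ → 0ℤ
    shift-zero zero    = refl
    shift-zero (suc k) = refl
    shift²-zero : shift² (λ _ → 0ℤ) ≗ λ _ → 0ℤ
    shift²-zero k = trans (shift-cong shift-zero k) (shift-zero k)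
    vanish : ∀ c C → 0ℤ + c * 0ℤ + C * 0ℤ - 0ℤ ≡ 0ℤ
    vanish = solve-∀

  Λ-⊕ : ∀ c C f g → Λ c C (f ⊕ g) ≗ Λ c C f ⊕ Λ c C g
  Λ-⊕ c C f g m = trans
    (Λ-expand c C (f ⊕ g) (θ-⊕ f g m) (shift-⊕ f g m) (shift²-⊕ f g m)
                        (trans (shift²-cong (θ-⊕ f g) m) (shift²-⊕ (θ f) (θ g) m)))
    (regroup c C (θ f m) (θ g m) (shift f m) (shift g m) (shift² f m) (shift² g m) (shift² (θ f) m) (shift² (θ g) m))
    where
    regroup : ∀ c C a a′ b b′ d d′ e e′ →
      a + a′ + c * (b + b′) + C * (d + d′) - (e + e′) ≡ (a + c * b + C * d - e) + (a′ + c * b′ + C * d′ - e′)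
    regroup = solve-∀

  Λ-· : ∀ c C k f → Λ c C (k · f) ≗ k · Λ c C f
  Λ-· c C k f m = trans
    (Λ-expand c C (k · f) (θ-· k f m) (shift-· k f m) (shift²-· k f m)
                        (trans (shift²-cong (θ-· k f) m) (shift²-· k (θ f) m)))
    (factor c C k (θ f m) (shift f m) (shift² f m) (shift² (θ f) m))
    where
    factor : ∀ c C k a b d e → k * a + c * (k * b) + C * (k * d) - k * e ≡ k * (a + c * b + C * d - e)
    factor = solve-∀

  Λ-∑ : ∀ c C n (a : ℕ → ℤ) (G : ℕ → Seq) →
        Λ c C (λ m → ∑[ j < n ] (a j * G j m)) ≗ λ m → ∑[ j < n ] (a j * Λ c C (G j) m)
  Λ-∑ c C zero    a G = Λ-zero c C
  Λ-∑ c C (suc n) a G m = trans (Λ-⊕ c C (a 0 · G 0) (λ k → ∑[ j < n ] (a (suc j) * G (suc j) k)) m)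
                                (cong₂ _+_ (Λ-· c C (a 0) (G 0) m) (Λ-∑ c C n (a ∘ suc) (G ∘ suc) m))

  Λ-ι : ∀ c C r → Λ c C (ι r) ≗ + r · ι r ⊕ c · ι (suc r) ⊕ (C - + r) · ι (suc (suc r))
  Λ-ι c C r m = trans
    (Λ-expand c C (ι r) (θ-ι r m) (shift-ι r m) (shift²-ι m)
                      (trans (shift²-cong (θ-ι r) m) (trans (shift²-· (+ r) (ι r) m) (cong (+ r *_) (shift²-ι m)))))
    (collect c C (+ r) (ι r m) (ι (suc r) m) (ι (suc (suc r)) m))
    where
    shift²-ι : shift² (ι r) ≗ ι (suc (suc r))
    shift²-ι k = trans (shift-cong (shift-ι r) k) (shift-ι (suc r) k)
    collect : ∀ c C R a b d → R * a + c * b + C * d - R * d ≡ R * a + c * b + (C - R) * d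
    collect = solve-∀

  Λ-shift : ∀ c C f → Λ c (C + + 2) (shift f) ≗ shift (Λ c C f ⊕ f ⊕ shift² f)
  Λ-shift c C f zero    = vanish c C
    where
    vanish : ∀ c C → 0ℤ + c * 0ℤ + (C + + 2) * 0ℤ - 0ℤ ≡ 0ℤ
    vanish = solve-∀
  Λ-shift c C f (suc m) = trans
    (Λ-expand c (C + + 2) (shift f) (θ-shift f (suc m)) refl refl
            (trans (shift-cong (θ-shift f) m) (shift-⊕ (shift (θ f)) (shift f) m)))
    (regroup c C (θ f m) (f m) (shift f m) (shift² f m) (shift² (θ f) m))
    where
    regroup : ∀ c C a x b d e → a + x + c * b + (C + + 2) * d - (e + d) ≡ a + c * b + C * d - e + x + d
    regroup = solve-∀

  Λ-regroup : ∀ c C f → Λ c C f ≗ θ f ⊕ c · shift f ⊕ shift² (C · f ⊖ θ f)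
  Λ-regroup c C f m = begin
    θ f m + c * shift f m + C * shift² f m - shift² (θ f) m
      ≡⟨ ℤ.+-assoc (θ f m + c * shift f m) (C * shift² f m) (- shift² (θ f) m) ⟩
    θ f m + c * shift f m + (C * shift² f m - shift² (θ f) m)
      ≡⟨ cong (λ x → θ f m + c * shift f m + (x - shift² (θ f) m)) (shift²-· C f m) ⟨
    θ f m + c * shift f m + (shift² (C · f) m - shift² (θ f) m)
      ≡⟨ cong (_+_ (θ f m + c * shift f m)) (shift²-⊖ m) ⟨
    θ f m + c * shift f m + shift² (C · f ⊖ θ f) m ∎
    where
    shift²-⊖ : shift² (C · f ⊖ θ f) ≗ shift² (C · f) ⊖ shift² (θ f)
    shift²-⊖ i = trans (shift-cong (shift-⊖ (C · f) (θ f)) i) (shift-⊖ (shift (C · f)) (shift (θ f)) i)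

  ⋆-Λ : ∀ c C f g →
        Λ c C f ⋆ g ≗ θ f ⋆ g ⊕ c · shift (f ⋆ g) ⊕ C · shift² (f ⋆ g) ⊖ shift² (θ f ⋆ g)
  ⋆-Λ c C f g m = begin
    ∑[ i < suc m ] ((θ f i + c * shift f i + C * shift² f i - shift² (θ f) i) * g (m ∸ i))
      ≡⟨ ∑-cong (suc m) (λ i _ → distrib c C (θ f i) (shift f i) (shift² f i) (shift² (θ f) i) (g (m ∸ i))) ⟩
    ∑[ i < suc m ] (θ f i * g (m ∸ i) + c * (shift f i * g (m ∸ i)) + C * (shift² f i * g (m ∸ i))
                    - shift² (θ f) i * g (m ∸ i))
      ≡⟨ ∑-combination (suc m) c C (λ i → θ f i * g (m ∸ i)) (λ i → shift f i * g (m ∸ i))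
                       (λ i → shift² f i * g (m ∸ i)) (λ i → shift² (θ f) i * g (m ∸ i)) ⟩
    (θ f ⋆ g) m + c * (shift f ⋆ g) m + C * (shift² f ⋆ g) m - (shift² (θ f) ⋆ g) m
      ≡⟨ cong₂ _-_ (cong₂ (λ x y → (θ f ⋆ g) m + c * x + C * y) (shift-⋆ f g m) (shift²-⋆ f g m))
                   (shift²-⋆ (θ f) g m) ⟩
    (θ f ⋆ g) m + c * shift (f ⋆ g) m + C * shift² (f ⋆ g) m - shift² (θ f ⋆ g) m ∎
    where
    distrib : ∀ c C a b d e x → (a + c * b + C * d - e) * x ≡ a * x + c * (b * x) + C * (d * x) - e * x
    distrib = solve-∀

  Λ-⋆ : ∀ c C f g →
        f ⋆ Λ c C g ≗ f ⋆ θ g ⊕ c · shift (f ⋆ g) ⊕ C · shift² (f ⋆ g) ⊖ shift² (f ⋆ θ g)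
  Λ-⋆ c C f g m = begin
    ∑[ i < suc m ] (f i * (θ g (m ∸ i) + c * shift g (m ∸ i) + C * shift² g (m ∸ i) - shift² (θ g) (m ∸ i)))
      ≡⟨ ∑-cong (suc m) (λ i _ → distrib c C (f i) (θ g (m ∸ i)) (shift g (m ∸ i)) (shift² g (m ∸ i))
                                                   (shift² (θ g) (m ∸ i))) ⟩
    ∑[ i < suc m ] (f i * θ g (m ∸ i) + c * (f i * shift g (m ∸ i)) + C * (f i * shift² g (m ∸ i))
                    - f i * shift² (θ g) (m ∸ i))
      ≡⟨ ∑-combination (suc m) c C (λ i → f i * θ g (m ∸ i)) (λ i → f i * shift g (m ∸ i))
                       (λ i → f i * shift² g (m ∸ i)) (λ i → f i * shift² (θ g) (m ∸ i)) ⟩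
    (f ⋆ θ g) m + c * (f ⋆ shift g) m + C * (f ⋆ shift² g) m - (f ⋆ shift² (θ g)) m
      ≡⟨ cong₂ _-_ (cong₂ (λ x y → (f ⋆ θ g) m + c * x + C * y) (⋆-shift f g m) (⋆-shift² f g m))
                   (⋆-shift² f (θ g) m) ⟩
    (f ⋆ θ g) m + c * shift (f ⋆ g) m + C * shift² (f ⋆ g) m - shift² (f ⋆ θ g) m ∎
    where
    distrib : ∀ c C x a b d e → x * (a + c * b + C * d - e) ≡ x * a + c * (x * b) + C * (x * d) - x * e
    distrib = solve-∀

  Λ-leibniz : ∀ c c′ C C′ f g → Λ c C f ⋆ g ⊕ f ⋆ Λ c′ C′ g ≗ Λ (c + c′) (C + C′) (f ⋆ g)
  Λ-leibniz c c′ C C′ f g m = begin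
    (Λ c C f ⋆ g) m + (f ⋆ Λ c′ C′ g) m
      ≡⟨ cong₂ _+_ (⋆-Λ c C f g m) (Λ-⋆ c′ C′ f g m) ⟩
    (θ f ⋆ g) m + c * shift (f ⋆ g) m + C * shift² (f ⋆ g) m - shift² (θ f ⋆ g) m
      + ((f ⋆ θ g) m + c′ * shift (f ⋆ g) m + C′ * shift² (f ⋆ g) m - shift² (f ⋆ θ g) m)
      ≡⟨ regroup c c′ C C′ ((θ f ⋆ g) m) ((f ⋆ θ g) m) (shift (f ⋆ g) m) (shift² (f ⋆ g) m)
                 (shift² (θ f ⋆ g) m) (shift² (f ⋆ θ g) m) ⟩
    (θ f ⋆ g) m + (f ⋆ θ g) m + (c + c′) * shift (f ⋆ g) m + (C + C′) * shift² (f ⋆ g) m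
      - (shift² (θ f ⋆ g) m + shift² (f ⋆ θ g) m)
      ≡⟨ Λ-expand (c + c′) (C + C′) (f ⋆ g) (θ-⋆ f g m) refl refl
                (trans (shift²-cong (θ-⋆ f g) m) (shift²-⊕ (θ f ⋆ g) (f ⋆ θ g) m)) ⟨
    Λ (c + c′) (C + C′) (f ⋆ g) m ∎
    where
    regroup : ∀ c c′ C C′ a a′ b d e e′ →
      a + c * b + C * d - e + (a′ + c′ * b + C′ * d - e′) ≡ a + a′ + (c + c′) * b + (C + C′) * d - (e + e′)
    regroup = solve-∀

module Recurrences where

  open import Data.Nat using (ℕ; zero; suc; pred; _∸_; _≤_; _<_)
  import Data.Nat as ℕ
  import Data.Nat.Properties as ℕ
  open import Data.Nat.Combinatorics using (_C_; nCk+nC[k+1]≡[n+1]C[k+1]; k>n⇒nCk≡0)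
  open import Data.Integer using (ℤ; +_; 0ℤ; 1ℤ; _+_; _-_; _*_)
  import Data.Integer.Properties as ℤ
  open import Data.Integer.Tactic.RingSolver using (solve-∀)
  open import Function using (_∘_)
  open import Relation.Binary.PropositionalEquality
  open ≡-Reasoning

  open PowerSeries

  -- The first steps use that suc n C 0 and n C 0 compute to 1.
  ∑-pascal : ∀ n (P : ℕ → ℤ) →
    ∑[ k < suc (suc n) ] (+ (suc n C k) * P k) ≡ ∑[ k < suc n ] (+ (n C k) * (P (suc k) + P k))
  ∑-pascal n P = begin
    + 1 * P 0 + ∑[ k < suc n ] (+ (suc n C suc k) * P (suc k))
      ≡⟨ cong (_+_ (+ 1 * P 0)) (trans (∑-cong (suc n) (λ k _ → pascal k)) (∑-distrib-+ (suc n) lower upper)) ⟩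
    + 1 * P 0 + (∑[ k < suc n ] lower k + ∑[ k < suc n ] upper k)
      ≡⟨ swap (+ 1 * P 0) (∑[ k < suc n ] lower k) (∑[ k < suc n ] upper k) ⟩
    ∑[ k < suc n ] lower k + ∑[ k < suc (suc n) ] (+ (n C k) * P k)
      ≡⟨ cong (_+_ (∑[ k < suc n ] lower k)) (trans (∑-last (suc n) (λ k → + (n C k) * P k)) drop-last) ⟩
    ∑[ k < suc n ] lower k + ∑[ k < suc n ] (+ (n C k) * P k)
      ≡⟨ ∑-distrib-+ (suc n) lower (λ k → + (n C k) * P k) ⟨
    ∑[ k < suc n ] (lower k + + (n C k) * P k)
      ≡⟨ ∑-cong (suc n) (λ k _ → sym (ℤ.*-distribˡ-+ (+ (n C k)) (P (suc k)) (P k))) ⟩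
    ∑[ k < suc n ] (+ (n C k) * (P (suc k) + P k)) ∎
    where
    lower upper : ℕ → ℤ
    lower k = + (n C k) * P (suc k)
    upper k = + (n C suc k) * P (suc k)
    pascal : ∀ k → + (suc n C suc k) * P (suc k) ≡ lower k + upper k
    pascal k = begin
      + (suc n C suc k) * P (suc k)            ≡⟨ cong (λ c → + c * P (suc k)) (nCk+nC[k+1]≡[n+1]C[k+1] n k) ⟨
      + (n C k ℕ.+ n C suc k) * P (suc k)      ≡⟨ cong (_* P (suc k)) (ℤ.pos-+ (n C k) (n C suc k)) ⟩
      (+ (n C k) + + (n C suc k)) * P (suc k)  ≡⟨ ℤ.*-distribʳ-+ (P (suc k)) (+ (n C k)) (+ (n C suc k)) ⟩
      lower k + upper k                        ∎
    swap : ∀ x y z → x + (y + z) ≡ y + (x + z)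
    swap = solve-∀
    drop-last : ∑[ k < suc n ] (+ (n C k) * P k) + + (n C suc n) * P (suc n) ≡ ∑[ k < suc n ] (+ (n C k) * P k)
    drop-last = trans (cong (λ c → ∑[ k < suc n ] (+ (n C k) * P k) + + c * P (suc n)) (k>n⇒nCk≡0 (ℕ.n<1+n n)))
                      (ℤ.+-identityʳ _)

  egfSquare : (ℕ → Seq) → ℕ → Seq
  egfSquare F n m = ∑[ k < suc n ] (+ (n C k) * (F k ⋆ F (n ∸ k)) m)

  egfSquare-step : ∀ c a (F : ℕ → Seq) → (∀ k → F (suc k) ≗ Λ c (a * + k) (F k)) →
                   ∀ n → egfSquare F (suc n) ≗ Λ (c + c) (a * + n) (egfSquare F n)
  egfSquare-step c a F rec n m = begin
    egfSquare F (suc n) m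
      ≡⟨ ∑-pascal n (λ k → (F k ⋆ F (suc n ∸ k)) m) ⟩
    ∑[ k < suc n ] (+ (n C k) * ((F (suc k) ⋆ F (n ∸ k)) m + (F k ⋆ F (suc n ∸ k)) m))
      ≡⟨ ∑-cong (suc n) (λ k k<1+n → cong (+ (n C k) *_) (product-step k (ℕ.≤-pred k<1+n))) ⟩
    ∑[ k < suc n ] (+ (n C k) * Λ (c + c) (a * + n) (F k ⋆ F (n ∸ k)) m)
      ≡⟨ Λ-∑ (c + c) (a * + n) (suc n) (λ k → + (n C k)) (λ k → F k ⋆ F (n ∸ k)) m ⟨
    Λ (c + c) (a * + n) (egfSquare F n) m ∎
    where
    weights : ∀ k → k ≤ n → a * + k + a * + (n ∸ k) ≡ a * + n
    weights k k≤n = begin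
      a * + k + a * + (n ∸ k)   ≡⟨ ℤ.*-distribˡ-+ a (+ k) (+ (n ∸ k)) ⟨
      a * (+ k + + (n ∸ k))     ≡⟨ cong (a *_) (ℤ.pos-+ k (n ∸ k)) ⟨
      a * + (k ℕ.+ (n ∸ k))     ≡⟨ cong (λ i → a * + i) (ℕ.m+[n∸m]≡n k≤n) ⟩
      a * + n                   ∎
    product-step : ∀ k → k ≤ n →
      (F (suc k) ⋆ F (n ∸ k)) m + (F k ⋆ F (suc n ∸ k)) m ≡ Λ (c + c) (a * + n) (F k ⋆ F (n ∸ k)) m
    product-step k k≤n = begin
      (F (suc k) ⋆ F (n ∸ k)) m + (F k ⋆ F (suc n ∸ k)) m
        ≡⟨ cong (λ i → (F (suc k) ⋆ F (n ∸ k)) m + (F k ⋆ F i) m) (ℕ.+-∸-assoc 1 k≤n) ⟩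
      (F (suc k) ⋆ F (n ∸ k)) m + (F k ⋆ F (suc (n ∸ k))) m
        ≡⟨ cong₂ _+_ (⋆-cong {g = F (n ∸ k)} (rec k) (λ _ → refl) m)
                     (⋆-cong {f = F k} (λ _ → refl) (rec (n ∸ k)) m) ⟩
      (Λ c (a * + k) (F k) ⋆ F (n ∸ k)) m + (F k ⋆ Λ c (a * + (n ∸ k)) (F (n ∸ k))) m
        ≡⟨ Λ-leibniz c c (a * + k) (a * + (n ∸ k)) (F k) (F (n ∸ k)) m ⟩
      Λ (c + c) (a * + k + a * + (n ∸ k)) (F k ⋆ F (n ∸ k)) m
        ≡⟨ cong (λ e → Λ (c + c) e (F k ⋆ F (n ∸ k)) m) (weights k k≤n) ⟩
      Λ (c + c) (a * + n) (F k ⋆ F (n ∸ k)) m ∎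

  -- W k = (1 + x²)ᵏ and B j k = (2x)ʲ (1 + x²)ᵏ.
  W : ℕ → Seq
  W zero    = ι 0
  W (suc k) = W k ⊕ shift² (W k)

  B : ℕ → ℕ → Seq
  B zero    k = W k
  B (suc j) k = + 2 · shift (B j k)

  θ-W : ∀ k → θ (W (suc k)) ≗ (+ 2 * + suc k) · shift² (W k)
  θ-W k m = begin
    θ (W k ⊕ shift² (W k)) m
      ≡⟨ θ-⊕ (W k) (shift² (W k)) m ⟩
    θ (W k) m + θ (shift² (W k)) m
      ≡⟨ cong (_+_ (θ (W k) m)) (θ-shift² (W k) m) ⟩
    θ (W k) m + (shift² (θ (W k)) m + + 2 * shift² (W k) m)
      ≡⟨ collect k ⟩
    (+ 2 * + suc k) * shift² (W k) m ∎
    where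
    collect : ∀ j → θ (W j) m + (shift² (θ (W j)) m + + 2 * shift² (W j) m) ≡ (+ 2 * + suc j) * shift² (W j) m
    collect zero = begin
      θ (ι 0) m + (shift² (θ (ι 0)) m + + 2 * shift² (ι 0) m)
        ≡⟨ cong₂ (λ x y → x + (y + + 2 * shift² (ι 0) m))
                 (θ-ι 0 m) (trans (shift²-cong (θ-ι 0) m) (shift²-· (+ 0) (ι 0) m)) ⟩
      + 0 * ι 0 m + (+ 0 * shift² (ι 0) m + + 2 * shift² (ι 0) m)
        ≡⟨ only-last (ι 0 m) (shift² (ι 0) m) ⟩
      (+ 2 * + 1) * shift² (ι 0) m ∎
      where
      only-last : ∀ x y → + 0 * x + (+ 0 * y + + 2 * y) ≡ (+ 2 * + 1) * y
      only-last = solve-∀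
    collect (suc j) = begin
      θ (W (suc j)) m + (shift² (θ (W (suc j))) m + + 2 * shift² (W (suc j)) m)
        ≡⟨ cong₂ (λ x y → x + (y + + 2 * shift² (W (suc j)) m))
                 (θ-W j m) (trans (shift²-cong (θ-W j) m) (shift²-· (+ 2 * + suc j) (shift² (W j)) m)) ⟩
      K * X + (K * shift² (shift² (W j)) m + + 2 * shift² (W (suc j)) m)
        ≡⟨ factor K X (shift² (shift² (W j)) m) (+ 2 * shift² (W (suc j)) m) ⟩
      K * (X + shift² (shift² (W j)) m) + + 2 * shift² (W (suc j)) m
        ≡⟨ cong (λ y → K * y + + 2 * shift² (W (suc j)) m) (shift²-⊕ (W j) (shift² (W j)) m) ⟨
      K * shift² (W (suc j)) m + + 2 * shift² (W (suc j)) m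
        ≡⟨ add-two (+ suc j) (shift² (W (suc j)) m) ⟩
      (+ 2 * + suc (suc j)) * shift² (W (suc j)) m ∎
      where
      K = + 2 * + suc j
      X = shift² (W j) m
      factor : ∀ K x y z → K * x + (K * y + z) ≡ K * (x + y) + z
      factor = solve-∀
      add-two : ∀ j y → + 2 * j * y + + 2 * y ≡ + 2 * (+ 1 + j) * y
      add-two = solve-∀

  B-suc : ∀ j k → B j (suc k) ≗ B j k ⊕ shift² (B j k)
  B-suc zero    k m = refl
  B-suc (suc j) k m = begin
    + 2 * shift (B j (suc k)) m
      ≡⟨ cong (+ 2 *_) (trans (shift-cong (B-suc j k) m) (shift-⊕ (B j k) (shift² (B j k)) m)) ⟩
    + 2 * (shift (B j k) m + shift² (shift (B j k)) m)
      ≡⟨ ℤ.*-distribˡ-+ (+ 2) (shift (B j k) m) (shift² (shift (B j k)) m) ⟩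
    + 2 * shift (B j k) m + + 2 * shift² (shift (B j k)) m
      ≡⟨ cong (_+_ (+ 2 * shift (B j k) m)) (shift²-· (+ 2) (shift (B j k)) m) ⟨
    B (suc j) k m + shift² (B (suc j) k) m ∎

  Λ-W : ∀ k → Λ (+ 2) (+ 2 * + k) (W k) ≗ B 1 k ⊕ + k · B 2 (pred k)
  Λ-W zero m = trans
    (Λ-expand (+ 2) (+ 2 * + 0) (ι 0) {m} (θ-ι 0 m) refl refl
            (trans (shift²-cong (θ-ι 0) m) (shift²-· (+ 0) (ι 0) m)))
    (vanish (ι 0 m) (shift (ι 0) m) (shift² (ι 0) m) (B 2 0 m))
    where
    vanish : ∀ a b d y → + 0 * a + + 2 * b + (+ 2 * + 0) * d - + 0 * d ≡ + 2 * b + + 0 * y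
    vanish = solve-∀
  Λ-W (suc k) m = begin
    Λ (+ 2) K (W (suc k)) m
      ≡⟨ Λ-expand (+ 2) K (W (suc k)) {m} (θ-W k m) refl (shift²-⊕ (W k) (shift² (W k)) m)
                (trans (shift²-cong (θ-W k) m) (shift²-· K (shift² (W k)) m)) ⟩
    K * X + + 2 * shift (W (suc k)) m + K * (X + Y) - K * Y
      ≡⟨ collect (+ suc k) X Y (shift (W (suc k)) m) ⟩
    + 2 * shift (W (suc k)) m + + suc k * (+ 2 * (+ 2 * X))
      ≡⟨ cong (λ y → + 2 * shift (W (suc k)) m + + suc k * (+ 2 * y)) (shift-· (+ 2) (shift (W k)) m) ⟨
    B 1 (suc k) m + + suc k * B 2 k m ∎
    where
    K = + 2 * + suc k
    X = shift² (W k) m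
    Y = shift² (shift² (W k)) m
    collect : ∀ k X Y b → (+ 2 * k) * X + + 2 * b + (+ 2 * k) * (X + Y) - (+ 2 * k) * Y ≡ + 2 * b + k * (+ 2 * (+ 2 * X))
    collect = solve-∀

  -- For k = 0 the junk value pred 0 = 0 is harmless: its coefficient is + k.
  Λ-B : ∀ j k → Λ (+ 2) (+ 2 * + (j ℕ.+ k)) (B j k) ≗
                + j · B j (suc k) ⊕ B (suc j) k ⊕ + k · B (suc (suc j)) (pred k)
  Λ-B zero    k m = trans (Λ-W k m) (cong (_+ + k * B 2 (pred k) m) (sym (ℤ.+-identityˡ (B 1 k m))))
  Λ-B (suc j) k m = begin
    Λ (+ 2) (+ 2 * + suc (j ℕ.+ k)) (+ 2 · shift (B j k)) m
      ≡⟨ cong (λ e → Λ (+ 2) e (+ 2 · shift (B j k)) m) (add-two (+ (j ℕ.+ k))) ⟩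
    Λ (+ 2) (w + + 2) (+ 2 · shift (B j k)) m
      ≡⟨ Λ-· (+ 2) (w + + 2) (+ 2) (shift (B j k)) m ⟩
    + 2 * Λ (+ 2) (w + + 2) (shift (B j k)) m
      ≡⟨ cong (+ 2 *_) (trans (Λ-shift (+ 2) w (B j k) m) (shift-cong ih m)) ⟩
    + 2 * shift V m
      ≡⟨ spread m ⟩
    (+ suc j · B (suc j) (suc k) ⊕ B (suc (suc j)) k ⊕ + k · B (suc (suc (suc j))) (pred k)) m ∎
    where
    w = + 2 * + (j ℕ.+ k)
    V = + j · B j (suc k) ⊕ B (suc j) k ⊕ + k · B (suc (suc j)) (pred k) ⊕ B j (suc k)
    add-two : ∀ n → + 2 * (+ 1 + n) ≡ + 2 * n + + 2
    add-two = solve-∀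
    ih : Λ (+ 2) w (B j k) ⊕ B j k ⊕ shift² (B j k) ≗ V
    ih i = trans (ℤ.+-assoc (Λ (+ 2) w (B j k) i) (B j k i) (shift² (B j k) i))
                 (cong₂ _+_ (Λ-B j k i) (sym (B-suc j k i)))
    spread : ∀ m → + 2 * shift V m ≡
             (+ suc j · B (suc j) (suc k) ⊕ B (suc (suc j)) k ⊕ + k · B (suc (suc (suc j))) (pred k)) m
    spread zero = zeros (+ suc j) (+ k)
      where
      zeros : ∀ a b → + 2 * 0ℤ ≡ a * (+ 2 * 0ℤ) + + 2 * 0ℤ + b * (+ 2 * 0ℤ)
      zeros = solve-∀
    spread (suc m) = expand (+ j) (+ k) (B j (suc k) m) (B (suc j) k m) (B (suc (suc j)) (pred k) m)
      where
      expand : ∀ j k a b d → + 2 * (j * a + b + k * d + a) ≡ (+ 1 + j) * (+ 2 * a) + + 2 * b + k * (+ 2 * d)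
      expand = solve-∀

  ∑-θ-drop-last : ∀ n (t b : ℕ → ℤ) → t (suc n) ≡ 0ℤ →
                  ∑[ j < suc (suc n) ] (θ t j * b j) ≡ ∑[ j < suc n ] (θ t j * b j)
  ∑-θ-drop-last n t b top = begin
    ∑[ j < suc (suc n) ] (θ t j * b j)                       ≡⟨ ∑-last (suc n) (λ j → θ t j * b j) ⟩
    ∑[ j < suc n ] (θ t j * b j) + + suc n * t (suc n) * b (suc n)
      ≡⟨ cong (λ x → ∑[ j < suc n ] (θ t j * b j) + + suc n * x * b (suc n)) top ⟩
    ∑[ j < suc n ] (θ t j * b j) + + suc n * 0ℤ * b (suc n)  ≡⟨ vanish _ (+ suc n) (b (suc n)) ⟩
    ∑[ j < suc n ] (θ t j * b j)                             ∎
    where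
    vanish : ∀ s k x → s + k * 0ℤ * x ≡ s
    vanish = solve-∀

  ∑-reindex-shift² : ∀ n (t b : ℕ → ℤ) →
    ∑[ j < suc (suc n) ] (shift² (+ n · t ⊖ θ t) j * b j) ≡ ∑[ j < suc n ] (+ (n ∸ j) * t j * b (suc (suc j)))
  ∑-reindex-shift² n t b = begin
    ∑[ j < suc (suc n) ] (shift² u j * b j)       ≡⟨ ∑-shift (suc n) (shift u) b ⟩
    ∑[ j < suc n ] (shift u j * b (suc j))        ≡⟨ ∑-shift n u (b ∘ suc) ⟩
    ∑[ j < n ] (u j * b (suc (suc j)))
      ≡⟨ ∑-cong n (λ j j<n → cong (_* b (suc (suc j))) (weight j (ℕ.<⇒≤ j<n))) ⟩
    ∑[ j < n ] (v j)                              ≡⟨ ℤ.+-identityʳ _ ⟨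
    ∑[ j < n ] (v j) + 0ℤ                         ≡⟨ cong (_+_ (∑[ j < n ] (v j))) last-vanishes ⟨
    ∑[ j < n ] (v j) + v n                        ≡⟨ ∑-last n v ⟨
    ∑[ j < suc n ] (v j)                          ∎
    where
    u = + n · t ⊖ θ t
    v : ℕ → ℤ
    v j = + (n ∸ j) * t j * b (suc (suc j))
    last-vanishes : v n ≡ 0ℤ
    last-vanishes = trans (cong (λ i → + i * t n * b (suc (suc n))) (ℕ.n∸n≡0 n)) (ℤ.*-zeroˡ (b (suc (suc n))))
    factor : ∀ a b x → a * x - b * x ≡ (a - b) * x
    factor = solve-∀
    weight : ∀ j → j ≤ n → u j ≡ + (n ∸ j) * t j
    weight j j≤n = trans (factor (+ n) (+ j) (t j)) (cong (_* t j) (trans (ℤ.m-n≡m⊖n n j) (ℤ.⊖-≥ j≤n)))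

  Λ-adjoint : ∀ n (t b : ℕ → ℤ) → t (suc n) ≡ 0ℤ →
    ∑[ j < suc (suc n) ] (Λ 1ℤ (+ n) t j * b j) ≡
    ∑[ j < suc n ] (t j * (+ j * b j + b (suc j) + + (n ∸ j) * b (suc (suc j))))
  Λ-adjoint n t b top = begin
    ∑[ j < suc (suc n) ] (Λ 1ℤ (+ n) t j * b j)
      ≡⟨ ∑-cong (suc (suc n)) (λ j _ → trans (cong (_* b j) (Λ-regroup 1ℤ (+ n) t j))
                                              (distrib (θ t j) (shift t j) (shift² u j) (b j))) ⟩
    ∑[ j < suc (suc n) ] (θ t j * b j + shift t j * b j + shift² u j * b j)
      ≡⟨ ∑-distrib-+₃ (suc (suc n)) (λ j → θ t j * b j) (λ j → shift t j * b j) (λ j → shift² u j * b j) ⟩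
    ∑[ j < suc (suc n) ] (θ t j * b j) + ∑[ j < suc (suc n) ] (shift t j * b j) + ∑[ j < suc (suc n) ] (shift² u j * b j)
      ≡⟨ cong₂ _+_ (cong₂ _+_ (∑-θ-drop-last n t b top) (∑-shift (suc n) t b)) (∑-reindex-shift² n t b) ⟩
    ∑[ j < suc n ] (θ t j * b j) + ∑[ j < suc n ] (t j * b (suc j)) + ∑[ j < suc n ] (+ (n ∸ j) * t j * b (suc (suc j)))
      ≡⟨ ∑-distrib-+₃ (suc n) (λ j → θ t j * b j) (λ j → t j * b (suc j))
                              (λ j → + (n ∸ j) * t j * b (suc (suc j))) ⟨
    ∑[ j < suc n ] (θ t j * b j + t j * b (suc j) + + (n ∸ j) * t j * b (suc (suc j)))
      ≡⟨ ∑-cong (suc n) (λ j _ → factor (+ j) (+ (n ∸ j)) (t j) (b j) (b (suc j)) (b (suc (suc j)))) ⟩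
    ∑[ j < suc n ] (t j * (+ j * b j + b (suc j) + + (n ∸ j) * b (suc (suc j)))) ∎
    where
    u = + n · t ⊖ θ t
    distrib : ∀ a s d x → (a + 1ℤ * s + d) * x ≡ a * x + s * x + d * x
    distrib = solve-∀
    factor : ∀ j k x a b d → j * x * a + x * b + k * x * d ≡ x * (j * a + b + k * d)
    factor = solve-∀

  substituted : (ℕ → Seq) → ℕ → Seq
  substituted T n m = ∑[ j < suc n ] (T n j * B j (n ∸ j) m)

  substituted-step : ∀ (T : ℕ → Seq) → (∀ n → T (suc n) ≗ Λ 1ℤ (+ n) (T n)) →
                     (∀ n j → n < j → T n j ≡ 0ℤ) →
                     ∀ n → substituted T (suc n) ≗ Λ (+ 2) (+ 2 * + n) (substituted T n)
  substituted-step T rec deg n m = begin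
    ∑[ j < suc (suc n) ] (T (suc n) j * b j)
      ≡⟨ ∑-cong (suc (suc n)) (λ j _ → cong (_* b j) (rec n j)) ⟩
    ∑[ j < suc (suc n) ] (Λ 1ℤ (+ n) (T n) j * b j)
      ≡⟨ Λ-adjoint n (T n) b (deg n (suc n) (ℕ.n<1+n n)) ⟩
    ∑[ j < suc n ] (T n j * (+ j * b j + b (suc j) + + (n ∸ j) * b (suc (suc j))))
      ≡⟨ ∑-cong (suc n) (λ j j<1+n → cong (T n j *_) (Λ-B-shifted j (ℕ.≤-pred j<1+n))) ⟩
    ∑[ j < suc n ] (T n j * Λ (+ 2) (+ 2 * + n) (B j (n ∸ j)) m)
      ≡⟨ Λ-∑ (+ 2) (+ 2 * + n) (suc n) (T n) (λ j → B j (n ∸ j)) m ⟨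
    Λ (+ 2) (+ 2 * + n) (substituted T n) m ∎
    where
    b : ℕ → ℤ
    b j = B j (suc n ∸ j) m
    Λ-B-shifted : ∀ j → j ≤ n →
      + j * b j + b (suc j) + + (n ∸ j) * b (suc (suc j)) ≡ Λ (+ 2) (+ 2 * + n) (B j (n ∸ j)) m
    Λ-B-shifted j j≤n = begin
      + j * b j + b (suc j) + + (n ∸ j) * b (suc (suc j))
        ≡⟨ cong₂ (λ k l → + j * B j k m + b (suc j) + + (n ∸ j) * B (suc (suc j)) l m)
                 (ℕ.+-∸-assoc 1 j≤n) (sym (ℕ.pred[m∸n]≡m∸[1+n] n j)) ⟩
      + j * B j (suc (n ∸ j)) m + B (suc j) (n ∸ j) m + + (n ∸ j) * B (suc (suc j)) (pred (n ∸ j)) m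
        ≡⟨ Λ-B j (n ∸ j) m ⟨
      Λ (+ 2) (+ 2 * + (j ℕ.+ (n ∸ j))) (B j (n ∸ j)) m
        ≡⟨ cong (λ i → Λ (+ 2) (+ 2 * + i) (B j (n ∸ j)) m) (ℕ.m+[n∸m]≡n j≤n) ⟩
      Λ (+ 2) (+ 2 * + n) (B j (n ∸ j)) m ∎

  egfSquare≗substituted :
    ∀ (F T : ℕ → Seq) → F 0 ≗ ι 0 → (∀ k → F (suc k) ≗ Λ 1ℤ (+ 2 * + k) (F k)) →
    T 0 0 ≡ 1ℤ → (∀ n → T (suc n) ≗ Λ 1ℤ (+ n) (T n)) → (∀ n j → n < j → T n j ≡ 0ℤ) →
    ∀ n → egfSquare F n ≗ substituted T n
  egfSquare≗substituted F T F₀ recF T₀ recT deg zero m = cong (_+ 0ℤ) (begin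
    + 1 * (F 0 ⋆ F 0) m  ≡⟨ ℤ.*-identityˡ _ ⟩
    (F 0 ⋆ F 0) m        ≡⟨ ⋆-cong F₀ F₀ m ⟩
    (ι 0 ⋆ ι 0) m        ≡⟨ ι₀-⋆ (ι 0) m ⟩
    ι 0 m                ≡⟨ ℤ.*-identityˡ _ ⟨
    1ℤ * ι 0 m           ≡⟨ cong (_* ι 0 m) T₀ ⟨
    T 0 0 * ι 0 m        ∎)
  egfSquare≗substituted F T F₀ recF T₀ recT deg (suc n) m = begin
    egfSquare F (suc n) m
      ≡⟨ egfSquare-step 1ℤ (+ 2) F recF n m ⟩
    Λ (+ 2) (+ 2 * + n) (egfSquare F n) m
      ≡⟨ Λ-cong (+ 2) (+ 2 * + n) (egfSquare≗substituted F T F₀ recF T₀ recT deg n) m ⟩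
    Λ (+ 2) (+ 2 * + n) (substituted T n) m
      ≡⟨ substituted-step T recT deg n m ⟨
    substituted T (suc n) m ∎

module Polynomials where

  open import Data.Nat using (ℕ; zero; suc; _∸_)
  import Data.Nat as ℕ
  import Data.Nat.Properties as ℕ
  open import Data.Nat.Combinatorics using (_C_)
  open import Data.Integer using (ℤ; +_; _+_; _*_)
  import Data.Integer.Properties as ℤ
  open import Data.List using ([]; _∷_; map; applyUpTo; upTo)
  open import Function using (_∘_; id)
  open import Relation.Binary.PropositionalEquality
  open ≡-Reasoning

  open PowerSeries
  open Recurrences

  series : Poly → Seq
  series p m = + coeff p m

  series-+P : ∀ p q → series (p +P q) ≗ series p ⊕ series q
  series-+P p q m = trans (cong +_ (coeff-+P p q m)) (ℤ.pos-+ (coeff p m) (coeff q m))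
    where
    coeff-+P : ∀ p q m → coeff (p +P q) m ≡ coeff p m ℕ.+ coeff q m
    coeff-+P []      q       m       = refl
    coeff-+P (a ∷ p) []      m       = sym (ℕ.+-identityʳ _)
    coeff-+P (a ∷ p) (b ∷ q) zero    = refl
    coeff-+P (a ∷ p) (b ∷ q) (suc m) = coeff-+P p q m

  series-scaleP : ∀ a p → series (scaleP a p) ≗ + a · series p
  series-scaleP a p m = trans (cong +_ (coeff-scaleP p m)) (ℤ.pos-* a (coeff p m))
    where
    coeff-scaleP : ∀ p m → coeff (scaleP a p) m ≡ a ℕ.* coeff p m
    coeff-scaleP []      m       = sym (ℕ.*-zeroʳ a)
    coeff-scaleP (b ∷ p) zero    = refl
    coeff-scaleP (b ∷ p) (suc m) = coeff-scaleP p m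

  series-0∷ : ∀ p → series (0 ∷ p) ≗ shift (series p)
  series-0∷ p zero    = refl
  series-0∷ p (suc m) = refl

  series-*P : ∀ p q → series (p *P q) ≗ series p ⋆ series q
  series-*P []      q m = sym (trans (∑-cong (suc m) (λ i _ → ℤ.*-zeroˡ (series q (m ∸ i)))) (∑-zero (suc m)))
  series-*P (a ∷ p) q m = begin
    series (scaleP a q +P (0 ∷ (p *P q))) m
      ≡⟨ series-+P (scaleP a q) (0 ∷ (p *P q)) m ⟩
    series (scaleP a q) m + series (0 ∷ (p *P q)) m
      ≡⟨ cong₂ _+_ (series-scaleP a q m) (trans (series-0∷ (p *P q) m) (shift-cong (series-*P p q) m)) ⟩
    + a * series q m + shift (series p ⋆ series q) m
      ≡⟨ ⋆-unfold (series (a ∷ p)) (series q) m ⟨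
    (series (a ∷ p) ⋆ series q) m ∎

  series-sumP : ∀ (g : ℕ → Poly) N → series (sumP (map g (upTo N))) ≗ λ m → ∑[ i < N ] series (g i) m
  series-sumP g N = go id N
    where
    go : ∀ f N → series (sumP (map g (applyUpTo f N))) ≗ λ m → ∑[ i < N ] series (g (f i)) m
    go f zero    m = refl
    go f (suc N) m = trans (series-+P (g (f 0)) (sumP (map g (applyUpTo (f ∘ suc) N))) m)
                           (cong (_+_ (series (g (f 0)) m)) (go (f ∘ suc) N m))

  series-1 : series (1 ∷ []) ≗ ι 0
  series-1 zero    = refl
  series-1 (suc m) = refl

  series-eP : series (0 ∷ 2 ∷ []) ≗ + 2 · shift (ι 0)
  series-eP zero          = refl
  series-eP (suc zero)    = refl
  series-eP (suc (suc m)) = refl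

  series-wP : series (1 ∷ 0 ∷ 1 ∷ []) ≗ ι 0 ⊕ shift² (ι 0)
  series-wP zero                = refl
  series-wP (suc zero)          = refl
  series-wP (suc (suc zero))    = refl
  series-wP (suc (suc (suc m))) = refl

  series-powP-wP : ∀ k → series (powP (1 ∷ 0 ∷ 1 ∷ []) k) ≗ W k
  series-powP-wP zero    = series-1
  series-powP-wP (suc k) m = begin
    series ((1 ∷ 0 ∷ 1 ∷ []) *P q) m
      ≡⟨ series-*P (1 ∷ 0 ∷ 1 ∷ []) q m ⟩
    (series (1 ∷ 0 ∷ 1 ∷ []) ⋆ series q) m
      ≡⟨ ⋆-cong series-wP (series-powP-wP k) m ⟩
    ((ι 0 ⊕ shift² (ι 0)) ⋆ W k) m
      ≡⟨ ⊕-⋆ (ι 0) (shift² (ι 0)) (W k) m ⟩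
    (ι 0 ⋆ W k) m + (shift² (ι 0) ⋆ W k) m
      ≡⟨ cong₂ _+_ (ι₀-⋆ (W k) m) (trans (shift²-⋆ (ι 0) (W k) m) (shift²-cong (ι₀-⋆ (W k)) m)) ⟩
    W (suc k) m ∎
    where
    q = powP (1 ∷ 0 ∷ 1 ∷ []) k

  series-eP*P : ∀ q → series ((0 ∷ 2 ∷ []) *P q) ≗ + 2 · shift (series q)
  series-eP*P q m = begin
    series ((0 ∷ 2 ∷ []) *P q) m                  ≡⟨ series-*P (0 ∷ 2 ∷ []) q m ⟩
    (series (0 ∷ 2 ∷ []) ⋆ series q) m            ≡⟨ ⋆-cong {g = series q} series-eP (λ _ → refl) m ⟩
    (+ 2 · shift (ι 0) ⋆ series q) m              ≡⟨ ·-⋆ (+ 2) (shift (ι 0)) (series q) m ⟩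
    + 2 * (shift (ι 0) ⋆ series q) m              ≡⟨ cong (+ 2 *_) (shift-⋆ (ι 0) (series q) m) ⟩
    + 2 * shift (ι 0 ⋆ series q) m                ≡⟨ cong (+ 2 *_) (shift-cong (ι₀-⋆ (series q)) m) ⟩
    + 2 * shift (series q) m                      ∎

  series-B : ∀ j k → series (powP (0 ∷ 2 ∷ []) j *P powP (1 ∷ 0 ∷ 1 ∷ []) k) ≗ B j k
  series-B zero    k m = begin
    series ((1 ∷ []) *P r) m            ≡⟨ series-*P (1 ∷ []) r m ⟩
    (series (1 ∷ []) ⋆ series r) m      ≡⟨ ⋆-cong series-1 (series-powP-wP k) m ⟩
    (ι 0 ⋆ W k) m                       ≡⟨ ι₀-⋆ (W k) m ⟩
    W k m                               ∎
    where
    r = powP (1 ∷ 0 ∷ 1 ∷ []) k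
  series-B (suc j) k m = begin
    series (((0 ∷ 2 ∷ []) *P p) *P r) m              ≡⟨ series-*P ((0 ∷ 2 ∷ []) *P p) r m ⟩
    (series ((0 ∷ 2 ∷ []) *P p) ⋆ series r) m        ≡⟨ ⋆-cong {g = series r} (series-eP*P p) (λ _ → refl) m ⟩
    (+ 2 · shift (series p) ⋆ series r) m            ≡⟨ ·-⋆ (+ 2) (shift (series p)) (series r) m ⟩
    + 2 * (shift (series p) ⋆ series r) m            ≡⟨ cong (+ 2 *_) (shift-⋆ (series p) (series r) m) ⟩
    + 2 * shift (series p ⋆ series r) m              ≡⟨ cong (+ 2 *_) (shift-cong (λ i → sym (series-*P p r i)) m) ⟩
    + 2 * shift (series (p *P r)) m                  ≡⟨ cong (+ 2 *_) (shift-cong (series-B j k) m) ⟩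
    B (suc j) k m                                    ∎
    where
    p = powP (0 ∷ 2 ∷ []) j
    r = powP (1 ∷ 0 ∷ 1 ∷ []) k

  series-lhsCoeff : ∀ n → series (lhsCoeff n) ≗ egfSquare (series ∘ Fpoly) n
  series-lhsCoeff n m = trans (series-sumP (λ k → scaleP (n C k) (Fpoly k *P Fpoly (n ∸ k))) (suc n) m)
    (∑-cong (suc n) (λ k _ → trans (series-scaleP (n C k) (Fpoly k *P Fpoly (n ∸ k)) m)
                                   (cong (+ (n C k) *_) (series-*P (Fpoly k) (Fpoly (n ∸ k)) m))))

  series-rhsCoeff : ∀ n → series (rhsCoeff n) ≗ substituted (series ∘ Tpoly) n
  series-rhsCoeff n m = trans (series-sumP term (suc n) m)
    (∑-cong (suc n) (λ j _ → trans (series-scaleP (coeff (Tpoly n) j) (powP e j *P powP w (n ∸ j)) m)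
                                   (cong (+ coeff (Tpoly n) j *_) (series-B j (n ∸ j) m))))
    where
    e w : Poly
    e = 0 ∷ 2 ∷ []
    w = 1 ∷ 0 ∷ 1 ∷ []
    term : ℕ → Poly
    term j = scaleP (coeff (Tpoly n) j) (powP e j *P powP w (n ∸ j))

module DirectionChanges where

  open import Data.Nat using (ℕ; zero; suc; _≡ᵇ_)
  import Data.Nat as ℕ
  open import Data.Integer using (ℤ; +_; 0ℤ; 1ℤ; _+_; _-_; _*_)
  import Data.Integer.Properties as ℤ
  open import Data.Integer.Tactic.RingSolver using (solve-∀)
  open import Data.Bool using (Bool; true; false)
  open import Data.List using (List; []; _∷_; _++_; map; length; concatMap)
  import Data.List.Properties as List
  open import Data.List.Membership.Propositional using (_∈_)
  open import Data.List.Relation.Unary.Any using (here; there)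
  open import Data.List.Relation.Unary.All using (All; []; _∷_)
  open import Data.Empty using (⊥)
  open import Function using (_∘_)
  open import Relation.Binary.PropositionalEquality
  open ≡-Reasoning

  open PowerSeries

  hist : List ℕ → Seq
  hist xs k = + countB (_≡ᵇ k) xs

  hist-∷ : ∀ x xs → hist (x ∷ xs) ≗ ι x ⊕ hist xs
  hist-∷ x xs k with x ≡ᵇ k
  ... | true  = refl
  ... | false = refl

  hist-++ : ∀ xs ys → hist (xs ++ ys) ≗ hist xs ⊕ hist ys
  hist-++ []       ys k = sym (ℤ.+-identityˡ (hist ys k))
  hist-++ (x ∷ xs) ys k = begin
    hist (x ∷ xs ++ ys) k             ≡⟨ hist-∷ x (xs ++ ys) k ⟩
    ι x k + hist (xs ++ ys) k         ≡⟨ cong (_+_ (ι x k)) (hist-++ xs ys k) ⟩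
    ι x k + (hist xs k + hist ys k)   ≡⟨ ℤ.+-assoc (ι x k) (hist xs k) (hist ys k) ⟨
    ι x k + hist xs k + hist ys k     ≡⟨ cong (_+ hist ys k) (hist-∷ x xs k) ⟨
    hist (x ∷ xs) k + hist ys k       ∎

  hist-map-suc : ∀ xs → hist (map suc xs) ≗ shift (hist xs)
  hist-map-suc []       zero    = refl
  hist-map-suc []       (suc k) = refl
  hist-map-suc (x ∷ xs) k = begin
    hist (suc x ∷ map suc xs) k              ≡⟨ hist-∷ (suc x) (map suc xs) k ⟩
    ι (suc x) k + hist (map suc xs) k        ≡⟨ cong₂ _+_ (shift-ι x k) (sym (hist-map-suc xs k)) ⟨
    shift (ι x) k + shift (hist xs) k        ≡⟨ shift-⊕ (ι x) (hist xs) k ⟨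
    shift (ι x ⊕ hist xs) k                  ≡⟨ shift-cong (hist-∷ x xs) k ⟨
    shift (hist (x ∷ xs)) k                  ∎

  hist-concatMap : ∀ {A : Set} c C (g : A → List ℕ) (s : A → ℕ) (L : List A) →
                   (∀ {σ} → σ ∈ L → hist (g σ) ≗ Λ c C (ι (s σ))) →
                   hist (concatMap g L) ≗ Λ c C (hist (map s L))
  hist-concatMap c C g s []      each k = sym (Λ-zero c C k)
  hist-concatMap c C g s (σ ∷ L) each k = begin
    hist (g σ ++ concatMap g L) k                          ≡⟨ hist-++ (g σ) (concatMap g L) k ⟩
    hist (g σ) k + hist (concatMap g L) k                  ≡⟨ cong₂ _+_ (each (here refl) k)
                                                                (hist-concatMap c C g s L (each ∘ there) k) ⟩
    Λ c C (ι (s σ)) k + Λ c C (hist (map s L)) k           ≡⟨ Λ-⊕ c C (ι (s σ)) (hist (map s L)) k ⟨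
    Λ c C (ι (s σ) ⊕ hist (map s L)) k                     ≡⟨ Λ-cong c C (hist-∷ (s σ) (map s L)) k ⟨
    Λ c C (hist (map s (σ ∷ L))) k                         ∎

  differ : Bool → Bool → ℕ
  differ true  true  = 0
  differ false false = 0
  differ _     _     = 1

  changes : List Bool → ℕ
  changes (d ∷ d′ ∷ ds) = differ d d′ ℕ.+ changes (d′ ∷ ds)
  changes _             = 0

  lastOf : Bool → List Bool → Bool
  lastOf d []        = d
  lastOf _ (d′ ∷ ds) = lastOf d′ ds

  EndsDown : List Bool → Set
  EndsDown []       = ⊥
  EndsDown (d ∷ ds) = lastOf d ds ≡ false

  -- The direction sequences of the words obtained by inserting, after each letter but the first of
  -- a word with directions ds, a block that rises above both neighbours and has inner directions inner.
  insertPeak : List Bool → List Bool → List (List Bool)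
  insertPeak inner []       = (true ∷ inner) ∷ []
  insertPeak inner (d ∷ ds) = (true ∷ inner ++ false ∷ ds) ∷ map (d ∷_) (insertPeak inner ds)

  length-insertPeak : ∀ inner ds → length (insertPeak inner ds) ≡ suc (length ds)
  length-insertPeak inner []       = refl
  length-insertPeak inner (d ∷ ds) =
    cong suc (trans (List.length-map (d ∷_) (insertPeak inner ds)) (length-insertPeak inner ds))

  endsDown-insertPeak : ∀ d ds → EndsDown (d ∷ ds) → All EndsDown (insertPeak (false ∷ []) (d ∷ ds))
  endsDown-insertPeak d []        down = refl ∷ refl ∷ []
  endsDown-insertPeak d (d′ ∷ ds) down =
    down ∷ prepend (insertPeak (false ∷ []) (d′ ∷ ds)) (endsDown-insertPeak d′ ds down)
    where
    prepend : ∀ X → All EndsDown X → All EndsDown (map (d ∷_) X)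
    prepend []             []          = []
    prepend ((e ∷ es) ∷ X) (down ∷ rest) = down ∷ prepend X rest

  changesAfter : Bool → List Bool → List Bool → List ℕ
  changesAfter d inner ds = map (λ e → changes (d ∷ e)) (insertPeak inner ds)

  changesAfter-∷ : ∀ d d′ inner ds → changesAfter d inner (d′ ∷ ds) ≡
    changes (d ∷ true ∷ inner ++ false ∷ ds) ∷ map (differ d d′ ℕ.+_) (changesAfter d′ inner ds)
  changesAfter-∷ d d′ inner ds =
    cong (_ ∷_) (trans (sym (List.map-∘ (insertPeak inner ds))) (List.map-∘ (insertPeak inner ds)))

  record HasProfile (c z o : ℕ) (xs : List ℕ) : Set where
    constructor profile
    field
      hist≗ : hist xs ≗ + z · ι c ⊕ + o · ι (suc c) ⊕ (+ length xs - + z - + o) · ι (suc (suc c))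
  open HasProfile

  profile-[] : ∀ c → HasProfile c 0 0 []
  profile-[] c = profile (λ _ → refl)

  profile-∷-low : ∀ {c z o xs} → HasProfile c z o xs → HasProfile c (suc z) o (c ∷ xs)
  profile-∷-low {c} {z} {o} {xs} p = profile λ k →
    trans (hist-∷ c xs k) (trans (cong (_+_ (ι c k)) (hist≗ p k))
    (count (+ z) (+ o) (+ length xs) (ι c k) (ι (suc c) k) (ι (suc (suc c)) k)))
    where
    count : ∀ z o l a b d → a + (z * a + o * b + (l - z - o) * d) ≡ (+ 1 + z) * a + o * b + (+ 1 + l - (+ 1 + z) - o) * d
    count = solve-∀

  profile-∷-mid : ∀ {c z o xs} → HasProfile c z o xs → HasProfile c z (suc o) (suc c ∷ xs)
  profile-∷-mid {c} {z} {o} {xs} p = profile λ k →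
    trans (hist-∷ (suc c) xs k) (trans (cong (_+_ (ι (suc c) k)) (hist≗ p k))
    (count (+ z) (+ o) (+ length xs) (ι c k) (ι (suc c) k) (ι (suc (suc c)) k)))
    where
    count : ∀ z o l a b d → b + (z * a + o * b + (l - z - o) * d) ≡ z * a + (+ 1 + o) * b + (+ 1 + l - z - (+ 1 + o)) * d
    count = solve-∀

  profile-∷-high : ∀ {c z o xs} → HasProfile c z o xs → HasProfile c z o (suc (suc c) ∷ xs)
  profile-∷-high {c} {z} {o} {xs} p = profile λ k →
    trans (hist-∷ (suc (suc c)) xs k) (trans (cong (_+_ (ι (suc (suc c)) k)) (hist≗ p k))
    (count (+ z) (+ o) (+ length xs) (ι c k) (ι (suc c) k) (ι (suc (suc c)) k)))
    where
    count : ∀ z o l a b d → d + (z * a + o * b + (l - z - o) * d) ≡ z * a + o * b + (+ 1 + l - z - o) * d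
    count = solve-∀

  profile-map-suc : ∀ {c z o xs} → HasProfile c z o xs → HasProfile (suc c) z o (map suc xs)
  profile-map-suc {c} {z} {o} {xs} p = profile shifted
    where
    vanish : ∀ z o t → z * 0ℤ + o * 0ℤ + t * 0ℤ ≡ 0ℤ
    vanish = solve-∀
    shifted : hist (map suc xs) ≗ + z · ι (suc c) ⊕ + o · ι (suc (suc c))
                                  ⊕ (+ length (map suc xs) - + z - + o) · ι (suc (suc (suc c)))
    shifted zero    = trans (hist-map-suc xs 0) (sym (vanish (+ z) (+ o) (+ length (map suc xs) - + z - + o)))
    shifted (suc k) = trans (hist-map-suc xs (suc k)) (trans (hist≗ p k)
      (cong (λ l → + z * ι c k + + o * ι (suc c) k + (+ l - + z - + o) * ι (suc (suc c)) k)
            (sym (List.length-map suc xs))))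

  profile-offset : ∀ d d′ {c z o xs} → HasProfile c z o xs →
                       HasProfile (differ d d′ ℕ.+ c) z o (map (differ d d′ ℕ.+_) xs)
  profile-offset true  true  {c} {z} {o} {xs} p = subst (HasProfile c z o) (sym (List.map-id xs)) p
  profile-offset false false {c} {z} {o} {xs} p = subst (HasProfile c z o) (sym (List.map-id xs)) p
  profile-offset true  false {c} {z} {o} {xs} p = profile-map-suc {c} {z} {o} {xs} p
  profile-offset false true  {c} {z} {o} {xs} p = profile-map-suc {c} {z} {o} {xs} p

  keptByPair : Bool → List Bool → ℕ
  keptByPair true (true ∷ _) = 1
  keptByPair _    _          = 0

  -- In each case below, the new head value, the counts and the shift all reduce to the required ones
  -- by computation, so a case is settled by choosing the right profile-∷ lemma.
  pairProfile : ∀ d ds → lastOf d ds ≡ false →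
    HasProfile (changes (d ∷ ds)) (keptByPair d ds ℕ.+ changes (d ∷ ds)) 0 (changesAfter d (false ∷ []) ds)
  pairProfile-∷ : ∀ d d′ ds → lastOf d′ ds ≡ false →
    HasProfile (changes (d ∷ d′ ∷ ds)) (keptByPair d (d′ ∷ ds) ℕ.+ changes (d ∷ d′ ∷ ds)) 0
               (changes (d ∷ true ∷ false ∷ false ∷ ds) ∷
                map (differ d d′ ℕ.+_) (changesAfter d′ (false ∷ []) ds))

  pairProfile false []        _    = profile-∷-high (profile-[] 0)
  pairProfile d     (d′ ∷ ds) down =
    subst (HasProfile _ _ 0) (sym (changesAfter-∷ d d′ (false ∷ []) ds)) (pairProfile-∷ d d′ ds down)

  pairProfile-∷ true  false ds            down = profile-∷-low  (profile-offset true false (pairProfile false ds down))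
  pairProfile-∷ false false ds            down = profile-∷-high (profile-offset false false (pairProfile false ds down))
  pairProfile-∷ true  true  (true ∷ ds)   down = profile-∷-high (profile-offset true true (pairProfile true (true ∷ ds) down))
  pairProfile-∷ true  true  (false ∷ ds)  down = profile-∷-low  (profile-offset true true (pairProfile true (false ∷ ds) down))
  pairProfile-∷ false true  (true ∷ ds)   down = profile-∷-high (profile-offset false true (pairProfile true (true ∷ ds) down))
  pairProfile-∷ false true  (false ∷ ds)  down = profile-∷-low  (profile-offset false true (pairProfile true (false ∷ ds) down))

  keptBySingle : Bool → List Bool → ℕ
  keptBySingle true []         = 1
  keptBySingle true (true ∷ _) = 1
  keptBySingle _    _          = 0

  raisedBySingle : Bool → List Bool → ℕ
  raisedBySingle false _       = 1
  raisedBySingle true  []      = 0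
  raisedBySingle true  (_ ∷ _) = 1

  singleProfile : ∀ d ds →
    HasProfile (changes (d ∷ ds)) (keptBySingle d ds ℕ.+ changes (d ∷ ds)) (raisedBySingle d ds) (changesAfter d [] ds)
  singleProfile-∷ : ∀ d d′ ds →
    HasProfile (changes (d ∷ d′ ∷ ds)) (keptBySingle d (d′ ∷ ds) ℕ.+ changes (d ∷ d′ ∷ ds)) 1
               (changes (d ∷ true ∷ false ∷ ds) ∷ map (differ d d′ ℕ.+_) (changesAfter d′ [] ds))

  singleProfile true  []        = profile-∷-low (profile-[] 0)
  singleProfile false []        = profile-∷-mid (profile-[] 0)
  singleProfile true  (d′ ∷ ds) =
    subst (HasProfile _ _ 1) (sym (changesAfter-∷ true d′ [] ds)) (singleProfile-∷ true d′ ds)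
  singleProfile false (d′ ∷ ds) =
    subst (HasProfile _ _ 1) (sym (changesAfter-∷ false d′ [] ds)) (singleProfile-∷ false d′ ds)

  singleProfile-∷ true  false ds           = profile-∷-low  (profile-offset true false (singleProfile false ds))
  singleProfile-∷ false false ds           = profile-∷-high (profile-offset false false (singleProfile false ds))
  singleProfile-∷ true  true  []           = profile-∷-mid  (profile-offset true true (singleProfile true []))
  singleProfile-∷ false true  []           = profile-∷-mid  (profile-offset false true (singleProfile true []))
  singleProfile-∷ true  true  (true ∷ ds)  = profile-∷-high (profile-offset true true (singleProfile true (true ∷ ds)))
  singleProfile-∷ true  true  (false ∷ ds) = profile-∷-low  (profile-offset true true (singleProfile true (false ∷ ds)))
  singleProfile-∷ false true  (true ∷ ds)  = profile-∷-high (profile-offset false true (singleProfile true (true ∷ ds)))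
  singleProfile-∷ false true  (false ∷ ds) = profile-∷-low  (profile-offset false true (singleProfile true (false ∷ ds)))

  pairInsertionProfile : ∀ d ds → lastOf d ds ≡ false →
    HasProfile (changes (d ∷ ds)) (suc (changes (d ∷ ds))) 1
               (map changes ((false ∷ false ∷ d ∷ ds) ∷ insertPeak (false ∷ []) (d ∷ ds)))
  pairInsertionProfile d ds down =
    subst (HasProfile _ _ 1)
          (cong (λ l → changes (false ∷ false ∷ d ∷ ds) ∷ changes (true ∷ false ∷ false ∷ ds) ∷ l)
                (List.map-∘ (insertPeak (false ∷ []) ds)))
          (first-two d ds down)
    where
    first-two : ∀ d ds → lastOf d ds ≡ false →
      HasProfile (changes (d ∷ ds)) (suc (changes (d ∷ ds))) 1
        (changes (false ∷ false ∷ d ∷ ds) ∷ changes (true ∷ false ∷ false ∷ ds) ∷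
         changesAfter d (false ∷ []) ds)
    first-two false ds           down = profile-∷-low (profile-∷-mid (pairProfile false ds down))
    first-two true  (true ∷ ds)  down = profile-∷-mid (profile-∷-high (pairProfile true (true ∷ ds) down))
    first-two true  (false ∷ ds) down = profile-∷-mid (profile-∷-low (pairProfile true (false ∷ ds) down))

  singleInsertionProfile : ∀ ds →
    HasProfile (changes (true ∷ ds)) (suc (changes (true ∷ ds))) 1 (map changes (insertPeak [] (true ∷ ds)))
  singleInsertionProfile ds =
    subst (HasProfile _ _ 1) (cong (changes (true ∷ false ∷ ds) ∷_) (List.map-∘ (insertPeak [] ds))) (first ds)
    where
    first : ∀ ds → HasProfile (changes (true ∷ ds)) (suc (changes (true ∷ ds))) 1
                              (changes (true ∷ false ∷ ds) ∷ changesAfter true [] ds)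
    first []           = profile-∷-mid (singleProfile true [])
    first (true ∷ ds)  = profile-∷-high (singleProfile true (true ∷ ds))
    first (false ∷ ds) = profile-∷-low (singleProfile true (false ∷ ds))

  profile-Λ : ∀ {c xs} N → HasProfile c (suc c) 1 xs → length xs ≡ suc N →
              hist (map suc xs) ≗ Λ 1ℤ (+ N) (ι (suc c))
  profile-Λ {c} {xs} N p len k = begin
    hist (map suc xs) k
      ≡⟨ hist≗ (profile-map-suc p) k ⟩
    + suc c * ι (suc c) k + + 1 * ι (suc (suc c)) k + (+ length (map suc xs) - + suc c - + 1) * ι (suc (suc (suc c))) k
      ≡⟨ cong (λ t → + suc c * ι (suc c) k + + 1 * ι (suc (suc c)) k + t * ι (suc (suc (suc c))) k)
              (trans (cong (λ l → + l - + suc c - + 1) (trans (List.length-map suc xs) len)) (drop-one (+ N) (+ suc c))) ⟩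
    + suc c * ι (suc c) k + + 1 * ι (suc (suc c)) k + (+ N - + suc c) * ι (suc (suc (suc c))) k
      ≡⟨ Λ-ι 1ℤ (+ N) (suc c) k ⟨
    Λ 1ℤ (+ N) (ι (suc c)) k ∎
    where
    drop-one : ∀ n x → + 1 + n - x - + 1 ≡ n - x
    drop-one = solve-∀

module PeakInsertion where

  open import Data.Nat using (ℕ; zero; suc; _+_; _<_; _≤_; _≡ᵇ_; _<ᵇ_; s≤s)
  import Data.Nat.Properties as ℕ
  open import Data.Bool using (Bool; true; false; not; if_then_else_)
  open import Data.List using (List; []; _∷_; _++_; map; length)
  import Data.List.Properties as List
  open import Data.List.Relation.Unary.All using (All; []; _∷_)
  import Data.List.Relation.Unary.All as All
  import Data.List.Relation.Unary.All.Properties as All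
  open import Data.List.Relation.Unary.Linked using (Linked; [-]; _∷_)
  open import Data.Empty using (⊥-elim)
  open import Data.Integer using (+_; 1ℤ)
  open import Function using (_∘_)
  open import Relation.Binary.PropositionalEquality
  open ≡-Reasoning

  open PowerSeries
  open DirectionChanges

  ≡ᵇ-refl : ∀ n → (n ≡ᵇ n) ≡ true
  ≡ᵇ-refl zero    = refl
  ≡ᵇ-refl (suc n) = ≡ᵇ-refl n

  ≡ᵇ-≢ : ∀ {m n} → m ≢ n → (m ≡ᵇ n) ≡ false
  ≡ᵇ-≢ {zero}  {zero}  m≢n = ⊥-elim (m≢n refl)
  ≡ᵇ-≢ {zero}  {suc n} m≢n = refl
  ≡ᵇ-≢ {suc m} {zero}  m≢n = refl
  ≡ᵇ-≢ {suc m} {suc n} m≢n = ≡ᵇ-≢ (m≢n ∘ cong suc)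

  <ᵇ-true : ∀ {m n} → m < n → (m <ᵇ n) ≡ true
  <ᵇ-true {zero}  {suc n} _         = refl
  <ᵇ-true {suc m} {suc n} (s≤s m<n) = <ᵇ-true m<n

  <ᵇ-false : ∀ {m n} → n ≤ m → (m <ᵇ n) ≡ false
  <ᵇ-false {m}     {zero}  _         = refl
  <ᵇ-false {suc m} {suc n} (s≤s n≤m) = <ᵇ-false n≤m

  <ᵇ-flip : ∀ {m n} → m ≢ n → (n <ᵇ m) ≡ not (m <ᵇ n)
  <ᵇ-flip {zero}  {zero}  m≢n = ⊥-elim (m≢n refl)
  <ᵇ-flip {zero}  {suc n} m≢n = refl
  <ᵇ-flip {suc m} {zero}  m≢n = refl
  <ᵇ-flip {suc m} {suc n} m≢n = <ᵇ-flip (m≢n ∘ cong suc)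

  dirs : List ℕ → List Bool
  dirs (a ∷ b ∷ w) = (a <ᵇ b) ∷ dirs (b ∷ w)
  dirs _           = []

  length-dirs : ∀ a w → length (dirs (a ∷ w)) ≡ length w
  length-dirs a []      = refl
  length-dirs a (b ∷ w) = cong suc (length-dirs b w)

  turnAt-differ : ∀ {a b c} → a ≢ b → b ≢ c → (if turnAt a b c then 1 else 0) ≡ differ (a <ᵇ b) (b <ᵇ c)
  turnAt-differ {a} {b} {c} a≢b b≢c rewrite <ᵇ-flip a≢b | <ᵇ-flip b≢c with a <ᵇ b | b <ᵇ c
  ... | true  | true  = refl
  ... | true  | false = refl
  ... | false | true  = refl
  ... | false | false = refl

  altrun-changes : ∀ a w → Linked _≢_ (a ∷ w) → altrun (a ∷ w) ≡ suc (changes (dirs (a ∷ w)))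
  altrun-changes a []      _          = refl
  altrun-changes a (b ∷ w) distinct = cong suc (turns-changes a b w distinct)
    where
    turns-changes : ∀ a b w → Linked _≢_ (a ∷ b ∷ w) → turns (a ∷ b ∷ w) ≡ changes (dirs (a ∷ b ∷ w))
    turns-changes a b []      _                   = refl
    turns-changes a b (c ∷ w) (a≢b ∷ b≢c ∷ rest) =
      cong₂ _+_ (turnAt-differ a≢b b≢c) (turns-changes b c w (b≢c ∷ rest))

  altrun-map-∷ : ∀ b X → All (Linked _≢_) (map (b ∷_) X) →
                 map altrun (map (b ∷_) X) ≡ map (suc ∘ changes) (map dirs (map (b ∷_) X))
  altrun-map-∷ b []      []                  = refl
  altrun-map-∷ b (w ∷ X) (distinct ∷ rest) = cong₂ _∷_ (altrun-changes b w distinct) (altrun-map-∷ b X rest)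

  insertions : List ℕ → List ℕ → List (List ℕ)
  insertions blk []      = blk ∷ []
  insertions blk (b ∷ σ) = (blk ++ b ∷ σ) ∷ map (b ∷_) (insertions blk σ)

  insertions-bounded : ∀ {L} blk ρ → All (_< L) blk → All (_< L) ρ → All (All (_< L)) (insertions blk ρ)
  insertions-bounded blk []      blk<L []           = blk<L ∷ []
  insertions-bounded blk (b ∷ ρ) blk<L (b<L ∷ ρ<L) =
    All.++⁺ blk<L (b<L ∷ ρ<L) ∷ All.map⁺ (All.map (b<L ∷_) (insertions-bounded blk ρ blk<L ρ<L))

  record IsPeak (L : ℕ) (blk : List ℕ) (inner : List Bool) : Set where
    field
      dirs-end        : ∀ {b} → b < L → dirs (b ∷ blk) ≡ true ∷ inner
      dirs-before     : ∀ {b c} x → b < L → c < L →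
                        dirs (b ∷ blk ++ c ∷ x) ≡ true ∷ inner ++ false ∷ dirs (c ∷ x)
      distinct-end    : ∀ {b} → b < L → Linked _≢_ (b ∷ blk)
      distinct-before : ∀ {b c x} → b < L → c < L → Linked _≢_ (c ∷ x) → Linked _≢_ (b ∷ blk ++ c ∷ x)

  module _ {L : ℕ} {blk : List ℕ} {inner : List Bool} (peak : IsPeak L blk inner) where
    open IsPeak peak

    dirs-insertions : ∀ b ρ → All (_< L) (b ∷ ρ) →
                      map dirs (map (b ∷_) (insertions blk ρ)) ≡ insertPeak inner (dirs (b ∷ ρ))
    dirs-insertions b []      (b<L ∷ [])          = cong (_∷ []) (dirs-end b<L)
    dirs-insertions b (c ∷ ρ) (b<L ∷ c<L ∷ ρ<L) =
      cong₂ _∷_ (dirs-before ρ b<L c<L)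
                (trans (dirs-∷ (insertions blk ρ)) (cong (map ((b <ᵇ c) ∷_)) (dirs-insertions c ρ (c<L ∷ ρ<L))))
      where
      dirs-∷ : ∀ X → map dirs (map (b ∷_) (map (c ∷_) X)) ≡ map ((b <ᵇ c) ∷_) (map dirs (map (c ∷_) X))
      dirs-∷ []      = refl
      dirs-∷ (x ∷ X) = cong (_ ∷_) (dirs-∷ X)

    distinct-insertions : ∀ b ρ → All (_< L) (b ∷ ρ) → Linked _≢_ (b ∷ ρ) →
                          All (Linked _≢_) (map (b ∷_) (insertions blk ρ))
    distinct-insertions b []      (b<L ∷ [])          _                  = distinct-end b<L ∷ []
    distinct-insertions b (c ∷ ρ) (b<L ∷ c<L ∷ ρ<L) (b≢c ∷ distinct) =
      distinct-before b<L c<L distinct ∷ prepend (insertions blk ρ) (distinct-insertions c ρ (c<L ∷ ρ<L) distinct)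
      where
      prepend : ∀ X → All (Linked _≢_) (map (c ∷_) X) → All (Linked _≢_) (map (b ∷_) (map (c ∷_) X))
      prepend []      []         = []
      prepend (x ∷ X) (lx ∷ lX) = (b≢c ∷ lx) ∷ prepend X lX

  pairPeak : ∀ B → IsPeak B (suc B ∷ B ∷ []) (false ∷ [])
  pairPeak B = record
    { dirs-end        = end
    ; dirs-before     = before
    ; distinct-end    = λ b<B → ℕ.<⇒≢ (ℕ.m<n⇒m<1+n b<B) ∷ ℕ.>⇒≢ (ℕ.n<1+n B) ∷ [-]
    ; distinct-before = λ b<B c<B rest →
                          ℕ.<⇒≢ (ℕ.m<n⇒m<1+n b<B) ∷ ℕ.>⇒≢ (ℕ.n<1+n B) ∷ ℕ.>⇒≢ c<B ∷ rest
    }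
    where
    end : ∀ {b} → b < B → dirs (b ∷ suc B ∷ B ∷ []) ≡ true ∷ false ∷ []
    end b<B rewrite <ᵇ-true (ℕ.m<n⇒m<1+n b<B) | <ᵇ-false (ℕ.n≤1+n B) = refl
    before : ∀ {b c} x → b < B → c < B →
             dirs (b ∷ suc B ∷ B ∷ c ∷ x) ≡ true ∷ false ∷ false ∷ dirs (c ∷ x)
    before x b<B c<B rewrite <ᵇ-true (ℕ.m<n⇒m<1+n b<B) | <ᵇ-false (ℕ.n≤1+n B) | <ᵇ-false (ℕ.<⇒≤ c<B) = refl

  singlePeak : ∀ M → IsPeak M (M ∷ []) []
  singlePeak M = record
    { dirs-end        = end
    ; dirs-before     = before
    ; distinct-end    = λ b<M → ℕ.<⇒≢ b<M ∷ [-]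
    ; distinct-before = λ b<M c<M rest → ℕ.<⇒≢ b<M ∷ ℕ.>⇒≢ c<M ∷ rest
    }
    where
    end : ∀ {b} → b < M → dirs (b ∷ M ∷ []) ≡ true ∷ []
    end b<M rewrite <ᵇ-true b<M = refl
    before : ∀ {b c} x → b < M → c < M → dirs (b ∷ M ∷ c ∷ x) ≡ true ∷ false ∷ dirs (c ∷ x)
    before x b<M c<M rewrite <ᵇ-true b<M | <ᵇ-false (ℕ.<⇒≤ c<M) = refl

  record Admissible (B : ℕ) (ρ : List ℕ) : Set where
    field
      distinct : Linked _≢_ ρ
      bounded  : All (_< B) ρ
      endsDown : EndsDown (dirs ρ)

  module PairInsertion (B : ℕ) where

    block : List ℕ
    block = suc B ∷ B ∷ []

    front-dirs : ∀ {c} x → c < B → dirs (block ++ c ∷ x) ≡ false ∷ false ∷ dirs (c ∷ x)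
    front-dirs x c<B rewrite <ᵇ-false (ℕ.n≤1+n B) | <ᵇ-false (ℕ.<⇒≤ c<B) = refl

    dirs-pairInsertions : ∀ b ρ → All (_< B) (b ∷ ρ) →
      map dirs (insertions block (b ∷ ρ)) ≡
      (false ∷ false ∷ dirs (b ∷ ρ)) ∷ insertPeak (false ∷ []) (dirs (b ∷ ρ))
    dirs-pairInsertions b ρ (b<B ∷ ρ<B) =
      cong₂ _∷_ (front-dirs ρ b<B) (dirs-insertions (pairPeak B) b ρ (b<B ∷ ρ<B))

    distinct-pairInsertions : ∀ b ρ → All (_< B) (b ∷ ρ) → Linked _≢_ (b ∷ ρ) →
                              All (Linked _≢_) (insertions block (b ∷ ρ))
    distinct-pairInsertions b ρ (b<B ∷ ρ<B) distinct =
      (ℕ.>⇒≢ (ℕ.n<1+n B) ∷ ℕ.>⇒≢ b<B ∷ distinct) ∷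
      distinct-insertions (pairPeak B) b ρ (b<B ∷ ρ<B) distinct

    hist-altrun : ∀ ρ → Admissible B ρ →
                  hist (map altrun (insertions block ρ)) ≗ Λ 1ℤ (+ length ρ) (ι (altrun ρ))
    hist-altrun []          record { endsDown = () }
    hist-altrun (_ ∷ [])    record { endsDown = () }
    hist-altrun (b ∷ c ∷ ρ) adm k = begin
      hist (map altrun (insertions block (b ∷ c ∷ ρ))) k
        ≡⟨ cong (λ l → hist l k) altruns ⟩
      hist (map suc (map changes ((false ∷ false ∷ ds) ∷ insertPeak (false ∷ []) ds))) k
        ≡⟨ profile-Λ (length (b ∷ c ∷ ρ)) (pairInsertionProfile (b <ᵇ c) (dirs (c ∷ ρ)) endsDown) len k ⟩
      Λ 1ℤ (+ length (b ∷ c ∷ ρ)) (ι (suc (changes ds))) k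
        ≡⟨ cong (λ r → Λ 1ℤ (+ length (b ∷ c ∷ ρ)) (ι r) k) (altrun-changes b (c ∷ ρ) distinct) ⟨
      Λ 1ℤ (+ length (b ∷ c ∷ ρ)) (ι (altrun (b ∷ c ∷ ρ))) k ∎
      where
      open Admissible adm
      ds = dirs (b ∷ c ∷ ρ)
      len : length (map changes ((false ∷ false ∷ ds) ∷ insertPeak (false ∷ []) ds)) ≡ suc (length (b ∷ c ∷ ρ))
      len = cong suc (trans (List.length-map changes (insertPeak (false ∷ []) ds))
                            (trans (length-insertPeak (false ∷ []) ds) (cong suc (length-dirs b (c ∷ ρ)))))
      altruns : map altrun (insertions block (b ∷ c ∷ ρ)) ≡
                map suc (map changes ((false ∷ false ∷ ds) ∷ insertPeak (false ∷ []) ds))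
      altruns with distinct-pairInsertions b (c ∷ ρ) bounded distinct
      ... | first ∷ rest = begin
        map altrun (insertions block (b ∷ c ∷ ρ))
          ≡⟨ cong₂ _∷_ (altrun-changes (suc B) (B ∷ b ∷ c ∷ ρ) first)
                       (altrun-map-∷ b (insertions block (c ∷ ρ)) rest) ⟩
        map (suc ∘ changes) (map dirs (insertions block (b ∷ c ∷ ρ)))
          ≡⟨ cong (map (suc ∘ changes)) (dirs-pairInsertions b (c ∷ ρ) bounded) ⟩
        map (suc ∘ changes) ((false ∷ false ∷ ds) ∷ insertPeak (false ∷ []) ds)
          ≡⟨ List.map-∘ ((false ∷ false ∷ ds) ∷ insertPeak (false ∷ []) ds) ⟩
        map suc (map changes ((false ∷ false ∷ ds) ∷ insertPeak (false ∷ []) ds)) ∎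

    admissible-insertions : ∀ {ρ} → Admissible B ρ → All (Admissible (suc (suc B))) (insertions block ρ)
    admissible-insertions {[]}        record { endsDown = () }
    admissible-insertions {_ ∷ []}    record { endsDown = () }
    admissible-insertions {b ∷ c ∷ ρ} adm =
      combine (distinct-pairInsertions b (c ∷ ρ) bounded distinct)
              (insertions-bounded block (b ∷ c ∷ ρ) (ℕ.n<1+n (suc B) ∷ ℕ.m<n⇒m<1+n (ℕ.n<1+n B) ∷ [])
                                  (All.map lift bounded))
              (All.map⁻ (subst (All EndsDown) (sym (dirs-pairInsertions b (c ∷ ρ) bounded))
                               (endsDown ∷ endsDown-insertPeak (b <ᵇ c) (dirs (c ∷ ρ)) endsDown)))
      where
      open Admissible adm
      lift : ∀ {x} → x < B → x < suc (suc B)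
      lift = ℕ.m<n⇒m<1+n ∘ ℕ.m<n⇒m<1+n
      combine : ∀ {X} → All (Linked _≢_) X → All (All (_< suc (suc B))) X → All (EndsDown ∘ dirs) X →
                All (Admissible (suc (suc B))) X
      combine []       []       []       = []
      combine (d ∷ ds) (b ∷ bs) (e ∷ es) = record { distinct = d ; bounded = b ; endsDown = e } ∷ combine ds bs es

  module SingleInsertion (M : ℕ) where

    udruns : ∀ b σ → 0 < b → All (_< M) (b ∷ σ) → Linked _≢_ (0 ∷ b ∷ σ) →
      map udrun (insertions (M ∷ []) (b ∷ σ)) ≡ map suc (map changes (insertPeak [] (true ∷ dirs (b ∷ σ))))
    udruns b σ 0<b bounded distinct = begin
      map udrun (insertions (M ∷ []) (b ∷ σ))
        ≡⟨ List.map-∘ (insertions (M ∷ []) (b ∷ σ)) ⟩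
      map altrun (map (0 ∷_) (insertions (M ∷ []) (b ∷ σ)))
        ≡⟨ altrun-map-∷ 0 (insertions (M ∷ []) (b ∷ σ))
                        (distinct-insertions (singlePeak M) 0 (b ∷ σ) (0<M ∷ bounded) distinct) ⟩
      map (suc ∘ changes) (map dirs (map (0 ∷_) (insertions (M ∷ []) (b ∷ σ))))
        ≡⟨ cong (map (suc ∘ changes)) (dirs-insertions (singlePeak M) 0 (b ∷ σ) (0<M ∷ bounded)) ⟩
      map (suc ∘ changes) (insertPeak [] (dirs (0 ∷ b ∷ σ)))
        ≡⟨ cong (λ d → map (suc ∘ changes) (insertPeak [] (d ∷ dirs (b ∷ σ)))) (<ᵇ-true 0<b) ⟩
      map (suc ∘ changes) (insertPeak [] (true ∷ dirs (b ∷ σ)))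
        ≡⟨ List.map-∘ (insertPeak [] (true ∷ dirs (b ∷ σ))) ⟩
      map suc (map changes (insertPeak [] (true ∷ dirs (b ∷ σ)))) ∎
      where
      0<M : 0 < M
      0<M = ℕ.<-trans 0<b (All.head bounded)

    hist-udrun : ∀ b σ → 0 < b → All (_< M) (b ∷ σ) → Linked _≢_ (0 ∷ b ∷ σ) →
      hist (map udrun (insertions (M ∷ []) (b ∷ σ))) ≗ Λ 1ℤ (+ length (b ∷ σ)) (ι (udrun (b ∷ σ)))
    hist-udrun b σ 0<b bounded distinct k = begin
      hist (map udrun (insertions (M ∷ []) (b ∷ σ))) k
        ≡⟨ cong (λ l → hist l k) (udruns b σ 0<b bounded distinct) ⟩
      hist (map suc (map changes (insertPeak [] (true ∷ ds)))) k
        ≡⟨ profile-Λ (length (b ∷ σ)) (singleInsertionProfile ds) len k ⟩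
      Λ 1ℤ (+ length (b ∷ σ)) (ι (suc (changes (true ∷ ds)))) k
        ≡⟨ cong (λ r → Λ 1ℤ (+ length (b ∷ σ)) (ι r) k) runs ⟨
      Λ 1ℤ (+ length (b ∷ σ)) (ι (udrun (b ∷ σ))) k ∎
      where
      ds = dirs (b ∷ σ)
      len : length (map changes (insertPeak [] (true ∷ ds))) ≡ suc (length (b ∷ σ))
      len = trans (List.length-map changes (insertPeak [] (true ∷ ds)))
                  (trans (length-insertPeak [] (true ∷ ds)) (cong (suc ∘ suc) (length-dirs b σ)))
      runs : udrun (b ∷ σ) ≡ suc (changes (true ∷ ds))
      runs = trans (altrun-changes 0 (b ∷ σ) distinct) (cong (λ d → suc (changes (d ∷ ds))) (<ᵇ-true 0<b))

    distinct-insertions₀ : ∀ σ → All (_< M) σ → 0 < M → Linked _≢_ (0 ∷ σ) →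
                           All (Linked _≢_ ∘ (0 ∷_)) (insertions (M ∷ []) σ)
    distinct-insertions₀ σ bounded 0<M distinct =
      All.map⁻ (distinct-insertions (singlePeak M) 0 σ (0<M ∷ bounded) distinct)

module Enumeration where

  open import Data.Nat using (ℕ; zero; suc; _+_; _<_; _≤_; z≤n; s≤s)
  import Data.Nat.Properties as ℕ
  open import Data.Bool using (Bool; true; false; T; _∧_)
  open import Data.Bool.Properties using (T?)
  open import Data.Bool.ListAction using (all)
  open import Data.List using (List; []; _∷_; _++_; map; filter; concatMap; length; replicate)
  import Data.List.Properties as List
  open import Data.List.Relation.Unary.All using (All; []; _∷_)
  import Data.List.Relation.Unary.All as All
  import Data.List.Relation.Unary.All.Properties as All
  open import Data.List.Relation.Unary.Any using (here; there)
  open import Data.List.Relation.Unary.Unique.Propositional using (Unique; []; _∷_)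
  import Data.List.Relation.Unary.Unique.Propositional.Properties as Unique
  open import Data.List.Membership.Propositional using (_∈_; find; lose)
  open import Data.List.Membership.Propositional.Properties
    using (∈-map⁺; ∈-map⁻; ∈-filter⁺; ∈-filter⁻; ∈-concatMap⁺; ∈-concatMap⁻; ∈-upTo⁺; ∈-upTo⁻)
  open import Data.List.Membership.Propositional.Properties.WithK using (unique∧set⇒bag)
  open import Data.List.Relation.Binary.BagAndSetEquality using (∼bag⇒↭)
  open import Data.List.Relation.Binary.Permutation.Propositional using (_↭_)
  open import Data.List.Relation.Binary.Permutation.Propositional.Properties using (↭-length; filter-↭)
  open import Data.List.Relation.Binary.Disjoint.Propositional using (Disjoint)
  open import Data.Product using (_×_; _,_; proj₁; proj₂; ∃₂)
  open import Data.Sum using (_⊎_; inj₁; inj₂)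
  open import Data.Empty using (⊥-elim)
  open import Function using (_∘_; _⇔_; mk⇔; Equivalence)
  open import Relation.Binary.PropositionalEquality

  open PeakInsertion using (insertions)

  countB-∧ : ∀ {A : Set} (p q : A → Bool) xs → countB (λ w → p w ∧ q w) xs ≡ countB q (filter (T? ∘ p) xs)
  countB-∧ p q []       = refl
  countB-∧ p q (x ∷ xs) with p x
  ... | false = countB-∧ p q xs
  ... | true with q x
  ...   | true  = cong suc (countB-∧ p q xs)
  ...   | false = countB-∧ p q xs

  countB-map : ∀ {A B : Set} (p : B → Bool) (f : A → B) xs → countB p (map f xs) ≡ countB (p ∘ f) xs
  countB-map p f []       = refl
  countB-map p f (x ∷ xs) with p (f x)
  ... | true  = cong suc (countB-map p f xs)
  ... | false = countB-map p f xs

  countB-↭ : ∀ {A : Set} (q : A → Bool) {xs ys} → xs ↭ ys → countB q xs ≡ countB q ys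
  countB-↭ q xs↭ys = ↭-length (filter-↭ (T? ∘ q) xs↭ys)

  countB-enumeration : ∀ {A : Set} (p q : A → Bool) {xs ys : List A} → Unique xs → Unique ys →
                       (∀ {w} → w ∈ ys ⇔ (w ∈ xs × T (p w))) → countB (λ w → p w ∧ q w) xs ≡ countB q ys
  countB-enumeration p q {xs} {ys} !xs !ys enumerates = trans (countB-∧ p q xs) (countB-↭ q (∼bag⇒↭
    (unique∧set⇒bag (Unique.filter⁺ (T? ∘ p) !xs) !ys
      (mk⇔ (λ w∈ → Equivalence.from enumerates (∈-filter⁻ (T? ∘ p) w∈))
           (λ w∈ → let (w∈xs , pw) = Equivalence.to enumerates w∈ in ∈-filter⁺ (T? ∘ p) w∈xs pw)))))

  concatMap-unique : ∀ {A B : Set} (f : A → List B) {L : List A} → Unique L → (∀ {x} → x ∈ L → Unique (f x)) →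
                     (∀ {x y w} → x ∈ L → y ∈ L → w ∈ f x → w ∈ f y → x ≡ y) → Unique (concatMap f L)
  concatMap-unique f {[]}    []          _      _     = []
  concatMap-unique f {x ∷ L} (x∉L ∷ !L) !f fibres =
    Unique.++⁺ (!f (here refl))
               (concatMap-unique f !L (!f ∘ there) (λ x∈ y∈ → fibres (there x∈) (there y∈)))
               disjoint
    where
    disjoint : Disjoint (f x) (concatMap f L)
    disjoint (w∈fx , w∈rest) with find (∈-concatMap⁻ f w∈rest)
    ... | y , y∈L , w∈fy with fibres (here refl) (there y∈L) w∈fx w∈fy
    ...   | refl = All.lookup x∉L y∈L refl

  InRange : ℕ → ℕ → Set
  InRange m a = 0 < a × a < suc m

  ∈-oneTo⁺ : ∀ {m a} → InRange m a → a ∈ oneTo m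
  ∈-oneTo⁺ {m} {suc i} (_ , s≤s i<m) = ∈-map⁺ suc (∈-upTo⁺ i<m)

  ∈-oneTo⁻ : ∀ {m a} → a ∈ oneTo m → InRange m a
  ∈-oneTo⁻ a∈ with ∈-map⁻ suc a∈
  ... | i , i∈ , refl = s≤s z≤n , s≤s (∈-upTo⁻ i∈)

  extensions : ℕ → List ℕ → List (List ℕ)
  extensions m w = map (_∷ w) (oneTo m)

  ∈-words⁺ : ∀ {l m} w → length w ≡ l → All (InRange m) w → w ∈ words l m
  ∈-words⁺ {zero}  []      refl []           = here refl
  ∈-words⁺ {suc l} {m} (a ∷ w) len (a∈ ∷ w∈) =
    ∈-concatMap⁺ (extensions m) (lose (∈-words⁺ w (ℕ.suc-injective len) w∈) (∈-map⁺ (_∷ w) (∈-oneTo⁺ a∈)))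

  ∈-words⁻ : ∀ {l m w} → w ∈ words l m → length w ≡ l × All (InRange m) w
  ∈-words⁻ {zero}  (here refl) = refl , []
  ∈-words⁻ {suc l} {m} w∈ with find (∈-concatMap⁻ (extensions m) {words l m} w∈)
  ... | v , v∈ , w∈′ with ∈-map⁻ (_∷ v) w∈′
  ...   | a , a∈ , refl with ∈-words⁻ v∈
  ...     | len , v-range = cong suc len , ∈-oneTo⁻ a∈ ∷ v-range

  words-unique : ∀ l m → Unique (words l m)
  words-unique zero    m = [] ∷ []
  words-unique (suc l) m = concatMap-unique (extensions m) (words-unique l m)
    (λ _ → Unique.map⁺ (proj₁ ∘ List.∷-injective) (Unique.map⁺ ℕ.suc-injective (Unique.upTo⁺ m)))
    fibres
    where
    fibres : ∀ {v v′ w} → v ∈ words l m → v′ ∈ words l m →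
             w ∈ map (_∷ v) (oneTo m) → w ∈ map (_∷ v′) (oneTo m) → v ≡ v′
    fibres _ _ w∈ w∈′ with ∈-map⁻ (_∷ _) w∈ | ∈-map⁻ (_∷ _) w∈′
    ... | _ , _ , refl | _ , _ , eq = proj₂ (List.∷-injective eq)

  ∈-insertions⁺ : ∀ blk u v → u ++ blk ++ v ∈ insertions blk (u ++ v)
  ∈-insertions⁺ blk []      []      = here (List.++-identityʳ blk)
  ∈-insertions⁺ blk []      (b ∷ v) = here refl
  ∈-insertions⁺ blk (c ∷ u) v       = there (∈-map⁺ (c ∷_) (∈-insertions⁺ blk u v))

  ∈-insertions⁻ : ∀ blk σ {w} → w ∈ insertions blk σ → ∃₂ λ u v → σ ≡ u ++ v × w ≡ u ++ blk ++ v
  ∈-insertions⁻ blk []      (here refl) = [] , [] , refl , sym (List.++-identityʳ blk)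
  ∈-insertions⁻ blk (b ∷ σ) (here refl) = [] , b ∷ σ , refl , refl
  ∈-insertions⁻ blk (b ∷ σ) (there w∈) with ∈-map⁻ (b ∷_) w∈
  ... | w′ , w′∈ , refl with ∈-insertions⁻ blk σ w′∈
  ...   | u , v , refl , refl = b ∷ u , v , refl , refl

  split-unique : ∀ {a} rest {u u′ v v′ : List ℕ} → All (_≢ a) u → All (_≢ a) u′ →
                 u ++ (a ∷ rest) ++ v ≡ u′ ++ (a ∷ rest) ++ v′ → u ≡ u′ × v ≡ v′
  split-unique rest {[]}    {[]}     _             _             eq = refl , List.++-cancelˡ (_ ∷ rest) _ _ eq
  split-unique rest {[]}    {c ∷ u′} _             (c≢a ∷ _)     eq =
    ⊥-elim (c≢a (sym (proj₁ (List.∷-injective eq))))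
  split-unique rest {c ∷ u} {[]}     (c≢a ∷ _)     _             eq = ⊥-elim (c≢a (proj₁ (List.∷-injective eq)))
  split-unique rest {c ∷ u} {c′ ∷ u′} (_ ∷ u≢a)   (_ ∷ u′≢a)    eq with List.∷-injective eq
  ... | refl , eq′ with split-unique rest u≢a u′≢a eq′
  ...   | refl , refl = refl , refl

  insertions-unique : ∀ {a} rest σ → All (_≢ a) σ → Unique (insertions (a ∷ rest) σ)
  insertions-unique rest []      _           = [] ∷ []
  insertions-unique {a} rest (b ∷ σ) (b≢a ∷ σ≢a) =
    fresh (insertions (a ∷ rest) σ) ∷ Unique.map⁺ (proj₂ ∘ List.∷-injective) (insertions-unique rest σ σ≢a)
    where
    fresh : ∀ X → All ((a ∷ rest) ++ b ∷ σ ≢_) (map (b ∷_) X)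
    fresh []      = []
    fresh (x ∷ X) = (b≢a ∘ sym ∘ proj₁ ∘ List.∷-injective) ∷ fresh X

  insertions-fibres : ∀ {a} rest σ τ {w} → All (_≢ a) σ → All (_≢ a) τ →
                      w ∈ insertions (a ∷ rest) σ → w ∈ insertions (a ∷ rest) τ → σ ≡ τ
  insertions-fibres rest σ τ σ≢a τ≢a w∈σ w∈τ with ∈-insertions⁻ _ σ w∈σ | ∈-insertions⁻ _ τ w∈τ
  ... | u , v , refl , refl | u′ , v′ , refl , eq with split-unique rest (All.++⁻ˡ u σ≢a) (All.++⁻ˡ u′ τ≢a) eq
  ...   | refl , refl = refl

  length-insert : ∀ (u b v : List ℕ) → length (u ++ b ++ v) ≡ length b + length (u ++ v)
  length-insert []      b v = List.length-++ b
  length-insert (x ∷ u) b v = trans (cong suc (length-insert u b v)) (sym (ℕ.+-suc (length b) (length (u ++ v))))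

  InRange-weaken : ∀ {n x} → InRange n x → InRange (suc n) x
  InRange-weaken (0<x , x≤n) = 0<x , ℕ.m<n⇒m<1+n x≤n

  InRange-top : ∀ n → InRange (suc n) (suc n)
  InRange-top n = s≤s z≤n , ℕ.n<1+n (suc n)

  InRange-split : ∀ {n x} → InRange (suc n) x → InRange n x ⊎ x ≡ suc n
  InRange-split (0<x , x<2+n) with ℕ.m≤n⇒m<n∨m≡n (ℕ.≤-pred x<2+n)
  ... | inj₁ x<1+n = inj₁ (0<x , x<1+n)
  ... | inj₂ x≡1+n = inj₂ x≡1+n

  all-oneTo⁻ : ∀ (p : ℕ → Bool) n → T (all p (oneTo n)) → ∀ {i} → InRange n i → T (p i)
  all-oneTo⁻ p n holds i∈ = All.lookup (All.all⁺ p (oneTo n) holds) (∈-oneTo⁺ i∈)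

  all-oneTo⁺ : ∀ (p : ℕ → Bool) n → (∀ {i} → InRange n i → T (p i)) → T (all p (oneTo n))
  all-oneTo⁺ p n holds = All.all⁻ p (All.tabulate (holds ∘ ∈-oneTo⁻))

  -- The words w of length size n over 1 … n with good i w for all i ≤ n, listed by inserting
  -- suc copies copies of n at every position of those for n − 1.
  module ByInsertion
    (copies : ℕ) (size : ℕ → ℕ)
    (size-zero : size zero ≡ zero) (size-suc : ∀ n → size (suc n) ≡ suc copies + size n)
    (good : ℕ → List ℕ → Bool)
    (good-skip : ∀ {i a} u v → i < a → good i (u ++ replicate (suc copies) a ++ v) ≡ good i (u ++ v))
    (good-top : ∀ {a u v} → All (_< a) u → All (_< a) v → T (good a (u ++ replicate (suc copies) a ++ v)))
    (decompose : ∀ {a w} → T (good a w) → All (_≤ a) w →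
                 ∃₂ λ u v → w ≡ u ++ replicate (suc copies) a ++ v × All (_< a) u × All (_< a) v)
    where

    block : ℕ → List ℕ
    block a = replicate (suc copies) a

    length-block : ∀ a u v → length (u ++ block a ++ v) ≡ suc copies + length (u ++ v)
    length-block a u v = trans (length-insert u (block a) v) (cong (_+ length (u ++ v)) (List.length-replicate (suc copies)))

    Good : ℕ → List ℕ → Set
    Good n w = T (all (λ i → good i w) (oneTo n))

    enumeration : ℕ → List (List ℕ)
    enumeration zero    = [] ∷ []
    enumeration (suc n) = concatMap (insertions (block (suc n))) (enumeration n)

    enumeration-sound : ∀ n {w} → w ∈ enumeration n → w ∈ words (size n) n × Good n w
    enumeration-sound zero (here refl) = subst (λ l → [] ∈ words l zero) (sym size-zero) (here refl) , _
    enumeration-sound (suc n) w∈ with find (∈-concatMap⁻ (insertions (block (suc n))) {enumeration n} w∈)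
    ... | σ , σ∈ , w∈σ with ∈-insertions⁻ (block (suc n)) σ w∈σ
    ...   | u , v , refl , refl with enumeration-sound n σ∈
    ...     | σ∈words , σ-good with ∈-words⁻ σ∈words
    ...       | len , range =
      ∈-words⁺ (u ++ block (suc n) ++ v) (trans (length-block (suc n) u v)
                                                (trans (cong (suc copies +_) len) (sym (size-suc n))))
               (All.++⁺ (All.map InRange-weaken (All.++⁻ˡ u range))
                        (All.++⁺ (All.replicate⁺ (suc copies) (InRange-top n))
                                 (All.map InRange-weaken (All.++⁻ʳ u range)))) ,
      all-oneTo⁺ (λ i → good i (u ++ block (suc n) ++ v)) (suc n) good-at
      where
      good-at : ∀ {i} → InRange (suc n) i → T (good i (u ++ block (suc n) ++ v))
      good-at i∈ with InRange-split i∈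
      ... | inj₁ i∈n  =
        subst T (sym (good-skip u v (proj₂ i∈n))) (all-oneTo⁻ (λ i → good i (u ++ v)) n σ-good i∈n)
      ... | inj₂ refl = good-top (All.map proj₂ (All.++⁻ˡ u range)) (All.map proj₂ (All.++⁻ʳ u range))

    enumeration-complete : ∀ n {w} → w ∈ words (size n) n × Good n w → w ∈ enumeration n
    enumeration-complete zero    {[]}    _        = here refl
    enumeration-complete zero    {x ∷ w} (w∈ , _) = ⊥-elim (ℕ.1+n≢0 (trans (proj₁ (∈-words⁻ w∈)) size-zero))
    enumeration-complete (suc n) {w} (w∈ , w-good) with ∈-words⁻ w∈
    ... | len , range with decompose (all-oneTo⁻ (λ i → good i w) (suc n) w-good (InRange-top n))
                                     (All.map (ℕ.≤-pred ∘ proj₂) range)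
    ...   | u , v , refl , u<a , v<a =
      ∈-concatMap⁺ (insertions (block (suc n))) (lose σ∈ (∈-insertions⁺ (block (suc n)) u v))
      where
      positive : All (0 <_) (u ++ block (suc n) ++ v)
      positive = All.map proj₁ range
      σ-range : All (InRange n) (u ++ v)
      σ-range = All.++⁺ (All.zip (All.++⁻ˡ u positive , u<a))
                        (All.zip (All.++⁻ʳ (block (suc n)) (All.++⁻ʳ u positive) , v<a))
      σ-length : length (u ++ v) ≡ size n
      σ-length = ℕ.+-cancelˡ-≡ (suc copies) _ _ (trans (sym (length-block (suc n) u v)) (trans len (size-suc n)))
      σ-good : Good n (u ++ v)
      σ-good = all-oneTo⁺ (λ i → good i (u ++ v)) n λ i∈ →
        subst T (good-skip u v (proj₂ i∈))
                (all-oneTo⁻ (λ i → good i (u ++ block (suc n) ++ v)) (suc n) w-good (InRange-weaken i∈))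
      σ∈ : u ++ v ∈ enumeration n
      σ∈ = enumeration-complete n (∈-words⁺ (u ++ v) σ-length σ-range , σ-good)

    enumerates : ∀ n {w} → w ∈ enumeration n ⇔ (w ∈ words (size n) n × Good n w)
    enumerates n = mk⇔ (enumeration-sound n) (enumeration-complete n)

    enumeration-range : ∀ n {σ} → σ ∈ enumeration n → All (InRange n) σ
    enumeration-range n σ∈ = proj₂ (∈-words⁻ {size n} (proj₁ (enumeration-sound n σ∈)))

    enumeration-length : ∀ n {σ} → σ ∈ enumeration n → length σ ≡ size n
    enumeration-length n σ∈ = proj₁ (∈-words⁻ {size n} (proj₁ (enumeration-sound n σ∈)))

    enumeration-unique : ∀ n → Unique (enumeration n)
    enumeration-unique zero    = [] ∷ []
    enumeration-unique (suc n) = concatMap-unique (insertions (block (suc n))) (enumeration-unique n)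
      (λ σ∈ → insertions-unique (replicate copies (suc n)) _ (fresh σ∈))
      (λ σ∈ τ∈ → insertions-fibres (replicate copies (suc n)) _ _ (fresh σ∈) (fresh τ∈))
      where
      fresh : ∀ {σ} → σ ∈ enumeration n → All (_≢ suc n) σ
      fresh σ∈ = All.map (ℕ.<⇒≢ ∘ proj₂) (enumeration-range n σ∈)

module StirlingWords where

  open import Data.Nat using (ℕ; zero; suc; _+_; _*_; _<_; _≤_; _≡ᵇ_; _<ᵇ_; _≟_)
  import Data.Nat.Properties as ℕ
  open import Data.Bool using (Bool; true; false; T; not; _∧_)
  import Data.Bool.Properties as Bool
  open import Data.Bool.Properties using (T?)
  open import Data.Bool.ListAction using (all)
  open import Data.List using (List; []; _∷_; _++_; filter; length; replicate; takeWhile)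
  import Data.List.Properties as List
  open import Data.List.Relation.Unary.All using (All; []; _∷_)
  import Data.List.Relation.Unary.All as All
  import Data.List.Relation.Unary.All.Properties as All
  open import Data.Product using (_×_; _,_; proj₁; ∃₂)
  open import Data.Empty using (⊥-elim)
  open import Function using (_∘_; Equivalence)
  open import Relation.Nullary using (yes; no)
  open import Relation.Binary.PropositionalEquality
  open ≡-Reasoning

  open PeakInsertion using (≡ᵇ-refl; ≡ᵇ-≢; <ᵇ-true)
  open Enumeration using (module ByInsertion)

  occ-++ : ∀ i u v → occ i (u ++ v) ≡ occ i u + occ i v
  occ-++ i u v = trans (cong length (List.filter-++ (T? ∘ (i ≡ᵇ_)) u v)) (List.length-++ (filter (T? ∘ (i ≡ᵇ_)) u))

  occ-≢ : ∀ {i a} w → i ≢ a → occ i (a ∷ w) ≡ occ i w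
  occ-≢ w i≢a rewrite ≡ᵇ-≢ i≢a = refl

  occ-≡ : ∀ a w → occ a (a ∷ w) ≡ suc (occ a w)
  occ-≡ a w rewrite ≡ᵇ-refl a = refl

  occ-< : ∀ {a} u → All (_< a) u → occ a u ≡ 0
  occ-< []      []          = refl
  occ-< (x ∷ u) (x<a ∷ u<a) = trans (occ-≢ u (ℕ.>⇒≢ x<a)) (occ-< u u<a)

  occ-replicate-≢ : ∀ {i a} k → i ≢ a → occ i (replicate k a) ≡ 0
  occ-replicate-≢ zero    i≢a = refl
  occ-replicate-≢ (suc k) i≢a = trans (occ-≢ (replicate k _) i≢a) (occ-replicate-≢ k i≢a)

  occ-replicate-≡ : ∀ a k → occ a (replicate k a) ≡ k
  occ-replicate-≡ a zero    = refl
  occ-replicate-≡ a (suc k) = trans (occ-≡ a (replicate k a)) (cong suc (occ-replicate-≡ a k))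

  occ-skip : ∀ {i a} k u v → i ≢ a → occ i (u ++ replicate k a ++ v) ≡ occ i (u ++ v)
  occ-skip {i} {a} k u v i≢a = begin
    occ i (u ++ replicate k a ++ v)               ≡⟨ occ-++ i u (replicate k a ++ v) ⟩
    occ i u + occ i (replicate k a ++ v)          ≡⟨ cong (occ i u +_) (occ-++ i (replicate k a) v) ⟩
    occ i u + (occ i (replicate k a) + occ i v)   ≡⟨ cong (λ x → occ i u + (x + occ i v)) (occ-replicate-≢ k i≢a) ⟩
    occ i u + occ i v                             ≡⟨ occ-++ i u v ⟨
    occ i (u ++ v)                                ∎

  occ-top : ∀ {a} k u v → All (_< a) u → All (_< a) v → occ a (u ++ replicate k a ++ v) ≡ k
  occ-top {a} k u v u<a v<a = begin
    occ a (u ++ replicate k a ++ v)               ≡⟨ occ-++ a u (replicate k a ++ v) ⟩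
    occ a u + occ a (replicate k a ++ v)          ≡⟨ cong₂ _+_ (occ-< u u<a) (occ-++ a (replicate k a) v) ⟩
    occ a (replicate k a) + occ a v               ≡⟨ cong₂ _+_ (occ-replicate-≡ a k) (occ-< v v<a) ⟩
    k + 0                                         ≡⟨ ℕ.+-identityʳ k ⟩
    k                                             ∎

  occ-zero : ∀ {a} w → All (_≤ a) w → occ a w ≡ 0 → All (_< a) w
  occ-zero []      []          _    = []
  occ-zero {a} (x ∷ w) (x≤a ∷ w≤a) none with x ≟ a
  ... | yes refl = ⊥-elim (ℕ.1+n≢0 (trans (sym (occ-≡ x w)) none))
  ... | no  x≢a  = ℕ.≤∧≢⇒< x≤a x≢a ∷ occ-zero w w≤a (trans (sym (occ-≢ w (x≢a ∘ sym))) none)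

  first-occurrence : ∀ {a} w → All (_≤ a) w → occ a w ≢ 0 →
                     ∃₂ λ u v → w ≡ u ++ a ∷ v × All (_< a) u × occ a w ≡ suc (occ a v)
  first-occurrence []      []          some = ⊥-elim (some refl)
  first-occurrence {a} (b ∷ w) (b≤a ∷ w≤a) some with b ≟ a
  ... | yes refl = [] , w , refl , [] , occ-≡ b w
  ... | no  b≢a with first-occurrence w w≤a (some ∘ trans (occ-≢ w (b≢a ∘ sym)))
  ...   | u , v , refl , u<a , count =
    b ∷ u , v , refl , ℕ.≤∧≢⇒< b≤a b≢a ∷ u<a , trans (occ-≢ (u ++ a ∷ v) (b≢a ∘ sym)) count

  once : ℕ → List ℕ → Bool
  once i w = occ i w ≡ᵇ 1

  once-skip : ∀ {i a} u v → i < a → once i (u ++ a ∷ v) ≡ once i (u ++ v)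
  once-skip u v i<a = cong (_≡ᵇ 1) (occ-skip 1 u v (ℕ.<⇒≢ i<a))

  once-top : ∀ {a u v} → All (_< a) u → All (_< a) v → T (once a (u ++ a ∷ v))
  once-top {u = u} {v} u<a v<a rewrite occ-top 1 u v u<a v<a = _

  once-decompose : ∀ {a w} → T (once a w) → All (_≤ a) w →
                   ∃₂ λ u v → w ≡ u ++ a ∷ v × All (_< a) u × All (_< a) v
  once-decompose {a} {w} one w≤a with first-occurrence w w≤a (ℕ.1+n≢0 ∘ trans (sym (ℕ.≡ᵇ⇒≡ (occ a w) 1 one)))
  ... | u , v , refl , u<a , count = u , v , refl , u<a ,
    occ-zero v (All.tail (All.++⁻ʳ u w≤a)) (ℕ.suc-injective (trans (sym count) (ℕ.≡ᵇ⇒≡ _ 1 one)))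

  skipUntil : ℕ → List ℕ → List ℕ
  skipUntil i = takeWhile (T? ∘ not ∘ (i ≡ᵇ_))

  above : ℕ → List ℕ → Bool
  above i = all (i <ᵇ_)

  between-≢ : ∀ {i b} w → i ≢ b → between i (b ∷ w) ≡ between i w
  between-≢ w i≢b rewrite ≡ᵇ-≢ i≢b = refl

  between-≡ : ∀ i w → between i (i ∷ w) ≡ skipUntil i w
  between-≡ i w rewrite ≡ᵇ-refl i = refl

  between-< : ∀ {i} u w → All (_< i) u → between i (u ++ w) ≡ between i w
  between-< []      w []          = refl
  between-< (x ∷ u) w (x<i ∷ u<i) = trans (between-≢ (u ++ w) (ℕ.>⇒≢ x<i)) (between-< u w u<i)

  skipUntil-≢ : ∀ {i a} w → i ≢ a → skipUntil i (a ∷ w) ≡ a ∷ skipUntil i w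
  skipUntil-≢ w i≢a rewrite ≡ᵇ-≢ i≢a = refl

  skipUntil-≡ : ∀ i w → skipUntil i (i ∷ w) ≡ []
  skipUntil-≡ i w rewrite ≡ᵇ-refl i = refl

  above-skipUntil : ∀ {i a} u v → i < a → above i (skipUntil i (u ++ a ∷ a ∷ v)) ≡ above i (skipUntil i (u ++ v))
  above-skipUntil {i} {a} []      v i<a rewrite skipUntil-≢ (a ∷ v) (ℕ.<⇒≢ i<a) | skipUntil-≢ v (ℕ.<⇒≢ i<a)
                                              | <ᵇ-true i<a = refl
  above-skipUntil {i} {a} (c ∷ u) v i<a with i ≟ c
  ... | yes refl = cong (above i) (trans (skipUntil-≡ i (u ++ a ∷ a ∷ v)) (sym (skipUntil-≡ i (u ++ v))))
  ... | no  i≢c rewrite skipUntil-≢ (u ++ a ∷ a ∷ v) i≢c | skipUntil-≢ (u ++ v) i≢c =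
    cong ((i <ᵇ c) ∧_) (above-skipUntil u v i<a)

  above-between : ∀ {i a} u v → i < a → above i (between i (u ++ a ∷ a ∷ v)) ≡ above i (between i (u ++ v))
  above-between {i} {a} []      v i<a =
    cong (above i) (trans (between-≢ (a ∷ v) (ℕ.<⇒≢ i<a)) (between-≢ v (ℕ.<⇒≢ i<a)))
  above-between {i} {a} (c ∷ u) v i<a with i ≟ c
  ... | yes refl rewrite between-≡ i (u ++ a ∷ a ∷ v) | between-≡ i (u ++ v) = above-skipUntil u v i<a
  ... | no  i≢c  rewrite between-≢ (u ++ a ∷ a ∷ v) i≢c | between-≢ (u ++ v) i≢c = above-between u v i<a

  stirlingAt : ℕ → List ℕ → Bool
  stirlingAt i w = (occ i w ≡ᵇ 2) ∧ above i (between i w)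

  stirlingAt-skip : ∀ {i a} u v → i < a → stirlingAt i (u ++ a ∷ a ∷ v) ≡ stirlingAt i (u ++ v)
  stirlingAt-skip u v i<a = cong₂ _∧_ (cong (_≡ᵇ 2) (occ-skip 2 u v (ℕ.<⇒≢ i<a))) (above-between u v i<a)

  stirlingAt-top : ∀ {a u v} → All (_< a) u → All (_< a) v → T (stirlingAt a (u ++ a ∷ a ∷ v))
  stirlingAt-top {a} {u} {v} u<a v<a
    rewrite occ-top 2 u v u<a v<a | between-< u (a ∷ a ∷ v) u<a | between-≡ a (a ∷ v) | skipUntil-≡ a v = _

  stirling-decompose : ∀ {a w} → T (stirlingAt a w) → All (_≤ a) w →
                       ∃₂ λ u v → w ≡ u ++ a ∷ a ∷ v × All (_< a) u × All (_< a) v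
  stirling-decompose {a} {w} holds w≤a with Equivalence.to Bool.T-∧ holds
  ... | twice , increasing with first-occurrence w w≤a (ℕ.1+n≢0 ∘ trans (sym (ℕ.≡ᵇ⇒≡ (occ a w) 2 twice)))
  ...   | u , v , refl , u<a , count = second v (All.tail (All.++⁻ʳ u w≤a))
                                              (ℕ.suc-injective (trans (sym count) (ℕ.≡ᵇ⇒≡ _ 2 twice)))
                                              (subst (T ∘ above a) (between-< u (a ∷ v) u<a) increasing)
    where
    second : ∀ v → All (_≤ a) v → occ a v ≡ 1 → T (above a (between a (a ∷ v))) →
             ∃₂ λ u′ v′ → u ++ a ∷ v ≡ u′ ++ a ∷ a ∷ v′ × All (_< a) u′ × All (_< a) v′
    second []      _            ()     _
    second (c ∷ v) (c≤a ∷ v≤a) one above-a with c ≟ a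
    ... | yes refl = u , v , refl , u<a , occ-zero v v≤a (ℕ.suc-injective (trans (sym (occ-≡ c v)) one))
    ... | no  c≢a  = ⊥-elim (ℕ.<⇒≱ (ℕ.<ᵇ⇒< a c a<c) c≤a)
      where
      a<c : T (a <ᵇ c)
      a<c = proj₁ (Equivalence.to Bool.T-∧ (subst (T ∘ above a)
                     (trans (between-≡ a (c ∷ v)) (skipUntil-≢ v (c≢a ∘ sym))) above-a))

  module StirlingEnumeration =
    ByInsertion 1 (2 *_) refl (ℕ.*-suc 2) stirlingAt stirlingAt-skip stirlingAt-top stirling-decompose

  module PermutationEnumeration =
    ByInsertion 0 (λ n → n) refl (λ _ → refl) once once-skip once-top once-decompose

module DualStirling where

  open import Data.Nat using (ℕ; suc; _*_; _∸_; _<_; _≡ᵇ_)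
  import Data.Nat.Properties as ℕ
  open import Data.Bool using (true; false; _∨_; if_then_else_)
  open import Data.List using (List; []; _∷_; map; length)
  open import Data.List.Relation.Unary.All using (All; []; _∷_)
  import Data.List.Relation.Unary.All as All
  open import Data.Product using (_×_; _,_; proj₁; proj₂)
  import Data.List.Properties as List
  open import Function using (_∘_)
  open import Relation.Binary.PropositionalEquality
  open ≡-Reasoning

  open PeakInsertion using (insertions; ≡ᵇ-refl; ≡ᵇ-≢)

  phiGo-agree : ∀ S S′ w → All (λ j → elemB j S ≡ elemB j S′) w → phiGo S w ≡ phiGo S′ w
  phiGo-agree S S′ []      []         = refl
  phiGo-agree S S′ (j ∷ w) (eq ∷ eqs) rewrite eq with elemB j S′
  ... | true  = cong (_ ∷_) (phiGo-agree S S′ w eqs)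
  ... | false =
    cong (_ ∷_) (phiGo-agree (j ∷ S) (j ∷ S′) w (All.map (λ {i} eq′ → cong ((i ≡ᵇ j) ∨_) eq′) eqs))

  phiGo-forget : ∀ {a} S w → All (_< a) w → phiGo (a ∷ S) w ≡ phiGo S w
  phiGo-forget {a} S w w<a =
    phiGo-agree (a ∷ S) S w (All.map (λ {j} j<a → cong (_∨ elemB j S) (≡ᵇ-≢ (ℕ.<⇒≢ j<a))) w<a)

  elemB-absent : ∀ {a} S → All (_< a) S → elemB a S ≡ false
  elemB-absent []      []          = refl
  elemB-absent (s ∷ S) (s<a ∷ S<a) rewrite ≡ᵇ-≢ (ℕ.>⇒≢ s<a) = elemB-absent S S<a

  phiGo-pair : ∀ {a} S w → All (_< a) S → All (_< a) w → phiGo S (a ∷ a ∷ w) ≡ 2 * a ∷ 2 * a ∸ 1 ∷ phiGo S w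
  phiGo-pair {a} S w S<a w<a rewrite elemB-absent S S<a | ≡ᵇ-refl a = cong (λ l → _ ∷ _ ∷ l) (phiGo-forget S w w<a)

  phiStep : List ℕ → ℕ → ℕ × List ℕ
  phiStep S j = if elemB j S then (2 * j ∸ 1 , S) else (2 * j , j ∷ S)

  phiGo-∷ : ∀ S j w → phiGo S (j ∷ w) ≡ proj₁ (phiStep S j) ∷ phiGo (proj₂ (phiStep S j)) w
  phiGo-∷ S j w with elemB j S
  ... | true  = refl
  ... | false = refl

  phiStep-bounded : ∀ {a} S j → j < a → All (_< a) S → All (_< a) (proj₂ (phiStep S j))
  phiStep-bounded S j j<a S<a with elemB j S
  ... | true  = S<a
  ... | false = j<a ∷ S<a

  phiGo-insertions : ∀ {a} S σ → All (_< a) S → All (_< a) σ →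
                     map (phiGo S) (insertions (a ∷ a ∷ []) σ) ≡ insertions (2 * a ∷ 2 * a ∸ 1 ∷ []) (phiGo S σ)
  phiGo-insertions S []      S<a []          = cong (_∷ []) (phiGo-pair S [] S<a [])
  phiGo-insertions {a} S (j ∷ σ) S<a (j<a ∷ σ<a) = begin
    phiGo S (a ∷ a ∷ j ∷ σ) ∷ map (phiGo S) (map (j ∷_) X)
      ≡⟨ cong₂ _∷_ (phiGo-pair S (j ∷ σ) S<a (j<a ∷ σ<a)) (sym (List.map-∘ X)) ⟩
    (2 * a ∷ 2 * a ∸ 1 ∷ phiGo S (j ∷ σ)) ∷ map (phiGo S ∘ (j ∷_)) X
      ≡⟨ cong₂ _∷_ (cong (λ l → 2 * a ∷ 2 * a ∸ 1 ∷ l) (phiGo-∷ S j σ))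
                   (trans (List.map-cong (phiGo-∷ S j) X) (List.map-∘ X)) ⟩
    (2 * a ∷ 2 * a ∸ 1 ∷ c ∷ phiGo S′ σ) ∷ map (c ∷_) (map (phiGo S′) X)
      ≡⟨ cong (λ Y → (2 * a ∷ 2 * a ∸ 1 ∷ c ∷ phiGo S′ σ) ∷ map (c ∷_) Y)
              (phiGo-insertions S′ σ (phiStep-bounded S j j<a S<a) σ<a) ⟩
    insertions (2 * a ∷ 2 * a ∸ 1 ∷ []) (c ∷ phiGo S′ σ)
      ≡⟨ cong (insertions (2 * a ∷ 2 * a ∸ 1 ∷ [])) (phiGo-∷ S j σ) ⟨
    insertions (2 * a ∷ 2 * a ∸ 1 ∷ []) (phiGo S (j ∷ σ)) ∎
    where
    X = insertions (a ∷ a ∷ []) σ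
    c = proj₁ (phiStep S j)
    S′ = proj₂ (phiStep S j)

  length-phiGo : ∀ S w → length (phiGo S w) ≡ length w
  length-phiGo S []      = refl
  length-phiGo S (j ∷ w) = trans (cong length (phiGo-∷ S j w)) (cong suc (length-phiGo (proj₂ (phiStep S j)) w))

module Counting where

  open import Data.Nat using (ℕ; zero; suc; _*_; _∸_; _<_; _≤_; _≡ᵇ_; _<?_; z≤n; s≤s)
  import Data.Nat.Properties as ℕ
  open import Data.Integer using (ℤ; +_; 0ℤ; 1ℤ)
  import Data.Integer as ℤ
  import Data.Integer.Properties as ℤ
  open import Data.Integer.Tactic.RingSolver using (solve-∀)
  open import Data.Bool using (true; false; _∧_)
  open import Data.List using (List; []; _∷_; map; length; upTo; applyUpTo; concatMap)
  import Data.List.Properties as List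
  open import Data.List.Relation.Unary.All using (All; []; _∷_)
  import Data.List.Relation.Unary.All as All
  import Data.List.Relation.Unary.All.Properties as All
  open import Data.List.Relation.Unary.Any using (here)
  open import Data.List.Relation.Unary.Linked using (Linked; [-]; _∷_)
  open import Data.List.Membership.Propositional using (_∈_; find)
  open import Data.List.Membership.Propositional.Properties using (∈-map⁺; ∈-concatMap⁻)
  open import Data.Product using (_,_; proj₂)
  open import Data.Empty using (⊥-elim)
  open import Function using (_∘_; id)
  open import Relation.Nullary using (yes; no)
  open import Relation.Binary.PropositionalEquality
  open ≡-Reasoning

  open PowerSeries
  open DirectionChanges using (hist; hist-concatMap)
  open Polynomials using (series)
  open PeakInsertion
  open Enumeration
  open StirlingWords
  open DualStirling

  open StirlingEnumeration using () renaming (enumeration to stirling; enumerates to enumerates-stirling;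
    enumeration-unique to stirling-unique; enumeration-range to stirling-range; enumeration-length to stirling-length)
  open PermutationEnumeration using () renaming (enumeration to permutations; enumerates to enumerates-permutations;
    enumeration-unique to permutations-unique; enumeration-range to permutations-range;
    enumeration-length to permutations-length)

  coeff-map-upTo : ∀ (f : ℕ → ℕ) {N k} → k < N → coeff (map f (upTo N)) k ≡ f k
  coeff-map-upTo f = go id
    where
    go : ∀ g {N k} → k < N → coeff (map f (applyUpTo g N)) k ≡ f (g k)
    go g {suc N} {zero}  _         = refl
    go g {suc N} {suc k} (s≤s k<N) = go (g ∘ suc) k<N

  coeff-beyond : ∀ p {k} → length p ≤ k → coeff p k ≡ 0
  coeff-beyond []      _         = refl
  coeff-beyond (a ∷ p) (s≤s len) = coeff-beyond p len

  coeff-map-upTo-beyond : ∀ (f : ℕ → ℕ) {N k} → N ≤ k → coeff (map f (upTo N)) k ≡ 0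
  coeff-map-upTo-beyond f {N} N≤k =
    coeff-beyond (map f (upTo N)) (subst (_≤ _) (sym (trans (List.length-map f (upTo N)) (List.length-upTo N))) N≤k)

  hist-below : ∀ {k} xs → All (_< k) xs → hist xs k ≡ 0ℤ
  hist-below []       []          = refl
  hist-below (x ∷ xs) (x<k ∷ xs<k) rewrite ≡ᵇ-≢ (ℕ.<⇒≢ x<k) = hist-below xs xs<k

  turns-≤ : ∀ a b w → turns (a ∷ b ∷ w) ≤ length w
  turns-≤ a b []      = z≤n
  turns-≤ a b (c ∷ w) with turnAt a b c
  ... | true  = s≤s (turns-≤ b c w)
  ... | false = ℕ.m≤n⇒m≤1+n (turns-≤ b c w)

  altrun-≤ : ∀ w → altrun w ≤ length w
  altrun-≤ []          = z≤n
  altrun-≤ (a ∷ [])    = s≤s z≤n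
  altrun-≤ (a ∷ b ∷ w) = s≤s (ℕ.m≤n⇒m≤1+n (turns-≤ a b w))

  udrun-≤ : ∀ b w → udrun (b ∷ w) ≤ length (b ∷ w)
  udrun-≤ b w = s≤s (turns-≤ 0 b w)

  Fseries Tseries : ℕ → Seq
  Fseries n = series (Fpoly n)
  Tseries n = series (Tpoly n)

  Fseries-hist : ∀ m → Fseries (suc m) ≗ hist (map (altrun ∘ Φ) (stirling (suc m)))
  Fseries-hist m k with k <? suc (2 * suc m)
  ... | yes k<N = cong +_ (begin
    coeff (Fpoly (suc m)) k
      ≡⟨ coeff-map-upTo (λ k → countB (λ w → isStirling (suc m) w ∧ (altrun (Φ w) ≡ᵇ k)) (words (2 * suc m) (suc m)))
                        k<N ⟩
    countB (λ w → isStirling (suc m) w ∧ (altrun (Φ w) ≡ᵇ k)) (words (2 * suc m) (suc m))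
      ≡⟨ countB-enumeration (isStirling (suc m)) (λ w → altrun (Φ w) ≡ᵇ k)
                            (words-unique (2 * suc m) (suc m)) (stirling-unique (suc m)) (enumerates-stirling (suc m)) ⟩
    countB (λ w → altrun (Φ w) ≡ᵇ k) (stirling (suc m))
      ≡⟨ countB-map (_≡ᵇ k) (altrun ∘ Φ) (stirling (suc m)) ⟨
    countB (_≡ᵇ k) (map (altrun ∘ Φ) (stirling (suc m))) ∎)
  ... | no k≮N = trans (cong +_ (coeff-map-upTo-beyond _ (ℕ.≮⇒≥ k≮N)))
                       (sym (hist-below _ (All.map⁺ (All.tabulate short))))
    where
    short : ∀ {w} → w ∈ stirling (suc m) → altrun (Φ w) < k
    short {w} w∈ =
      ℕ.≤-<-trans (ℕ.≤-trans (altrun-≤ (Φ w)) (ℕ.≤-reflexive (trans (length-phiGo [] w) (stirling-length (suc m) w∈))))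
                  (ℕ.≮⇒≥ k≮N)

  Tseries-hist : ∀ m → Tseries (suc m) ≗ hist (map udrun (permutations (suc m)))
  Tseries-hist m k with k <? suc (suc m)
  ... | yes k<N = cong +_ (begin
    coeff (Tpoly (suc m)) k
      ≡⟨ coeff-map-upTo (λ k → countB (λ w → isPerm (suc m) w ∧ (udrun w ≡ᵇ k)) (words (suc m) (suc m))) k<N ⟩
    countB (λ w → isPerm (suc m) w ∧ (udrun w ≡ᵇ k)) (words (suc m) (suc m))
      ≡⟨ countB-enumeration (isPerm (suc m)) (λ w → udrun w ≡ᵇ k)
                            (words-unique (suc m) (suc m)) (permutations-unique (suc m)) (enumerates-permutations (suc m)) ⟩
    countB (λ w → udrun w ≡ᵇ k) (permutations (suc m))
      ≡⟨ countB-map (_≡ᵇ k) udrun (permutations (suc m)) ⟨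
    countB (_≡ᵇ k) (map udrun (permutations (suc m))) ∎)
  ... | no k≮N = trans (cong +_ (coeff-map-upTo-beyond _ (ℕ.≮⇒≥ k≮N)))
                       (sym (hist-below _ (All.map⁺ (All.tabulate short))))
    where
    short : ∀ {w} → w ∈ permutations (suc m) → udrun w < k
    short {[]}    w∈ = ⊥-elim (ℕ.0≢1+n (permutations-length (suc m) w∈))
    short {b ∷ w} w∈ =
      ℕ.≤-<-trans (ℕ.≤-trans (udrun-≤ b w) (ℕ.≤-reflexive (permutations-length (suc m) w∈))) (ℕ.≮⇒≥ k≮N)

  Tseries-degree : ∀ n j → n < j → Tseries n j ≡ 0ℤ
  Tseries-degree zero    (suc j) _   = refl
  Tseries-degree (suc m) j       n<j = cong +_ (coeff-map-upTo-beyond _ n<j)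

  Fseries-1 : Fseries 1 ≗ ι 1
  Fseries-1 zero                = refl
  Fseries-1 (suc zero)          = refl
  Fseries-1 (suc (suc zero))    = refl
  Fseries-1 (suc (suc (suc m))) = refl

  Tseries-1 : Tseries 1 ≗ ι 1
  Tseries-1 zero          = refl
  Tseries-1 (suc zero)    = refl
  Tseries-1 (suc (suc m)) = refl

  x-Λ : ι 1 ≗ Λ 1ℤ (+ 0) (series (1 ∷ []))
  x-Λ m = begin
    ι 1 m                                                          ≡⟨ only-linear (ι 0 m) (ι 1 m) (ι 2 m) ⟨
    + 0 ℤ.* ι 0 m ℤ.+ 1ℤ ℤ.* ι 1 m ℤ.+ (+ 0 ℤ.- + 0) ℤ.* ι 2 m    ≡⟨ Λ-ι 1ℤ (+ 0) 0 m ⟨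
    Λ 1ℤ (+ 0) (ι 0) m                                             ≡⟨ Λ-cong 1ℤ (+ 0) Polynomials.series-1 m ⟨
    Λ 1ℤ (+ 0) (series (1 ∷ [])) m                                 ∎
    where
    only-linear : ∀ x y z → + 0 ℤ.* x ℤ.+ 1ℤ ℤ.* y ℤ.+ (+ 0 ℤ.- + 0) ℤ.* z ≡ y
    only-linear = solve-∀

  Φ-insertions : ∀ m {τ} → All (_< suc (suc m)) τ →
                 map Φ (insertions (suc (suc m) ∷ suc (suc m) ∷ []) τ) ≡
                 insertions (PairInsertion.block (suc (2 * suc m))) (Φ τ)
  Φ-insertions m {τ} τ<a = trans (phiGo-insertions [] τ [] τ<a)
    (cong (λ d → insertions (d ∷ d ∸ 1 ∷ []) (Φ τ)) (ℕ.*-suc 2 (suc m)))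

  admissible-Φ : ∀ m {σ} → σ ∈ stirling (suc m) → Admissible (suc (2 * suc m)) (Φ σ)
  admissible-Φ zero    (here refl) = record
    { distinct = (λ ()) ∷ [-] ; bounded = s≤s (s≤s (s≤s z≤n)) ∷ s≤s (s≤s z≤n) ∷ [] ; endsDown = refl }
  admissible-Φ (suc m) {σ} σ∈
    with find (∈-concatMap⁻ (insertions (suc (suc m) ∷ suc (suc m) ∷ [])) {stirling (suc m)} σ∈)
  ... | τ , τ∈ , σ∈τ = subst (λ B → Admissible B (Φ σ)) (cong suc (sym (ℕ.*-suc 2 (suc m))))
    (All.lookup (PairInsertion.admissible-insertions (suc (2 * suc m)) (admissible-Φ m τ∈))
                (subst (Φ σ ∈_) (Φ-insertions m (All.map proj₂ (stirling-range (suc m) τ∈))) (∈-map⁺ Φ σ∈τ)))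

  distinct-permutation : ∀ m {σ} → σ ∈ permutations m → Linked _≢_ (0 ∷ σ)
  distinct-permutation zero    (here refl) = [-]
  distinct-permutation (suc m) {σ} σ∈ with find (∈-concatMap⁻ (insertions (suc m ∷ [])) {permutations m} σ∈)
  ... | τ , τ∈ , σ∈τ = All.lookup (SingleInsertion.distinct-insertions₀ (suc m) τ τ<a (s≤s z≤n) (distinct-permutation m τ∈)) σ∈τ
    where
    τ<a = All.map proj₂ (permutations-range m τ∈)

  hist-Φ-insertions : ∀ k {σ} → σ ∈ stirling (suc k) →
    hist (map (altrun ∘ Φ) (insertions (suc (suc k) ∷ suc (suc k) ∷ []) σ)) ≗
    Λ 1ℤ (+ 2 ℤ.* + suc k) (ι (altrun (Φ σ)))
  hist-Φ-insertions k {σ} σ∈ i = begin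
    hist (map (altrun ∘ Φ) (insertions (suc (suc k) ∷ suc (suc k) ∷ []) σ)) i
      ≡⟨ cong (λ l → hist l i) (trans (List.map-∘ (insertions (suc (suc k) ∷ suc (suc k) ∷ []) σ))
                                      (cong (map altrun) (Φ-insertions k (All.map proj₂ (stirling-range (suc k) σ∈))))) ⟩
    hist (map altrun (insertions (PairInsertion.block (suc (2 * suc k))) (Φ σ))) i
      ≡⟨ PairInsertion.hist-altrun (suc (2 * suc k)) (Φ σ) (admissible-Φ k σ∈) i ⟩
    Λ 1ℤ (+ length (Φ σ)) (ι (altrun (Φ σ))) i
      ≡⟨ cong (λ l → Λ 1ℤ l (ι (altrun (Φ σ))) i)
              (trans (cong +_ (trans (length-phiGo [] σ) (stirling-length (suc k) σ∈))) (ℤ.pos-* 2 (suc k))) ⟩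
    Λ 1ℤ (+ 2 ℤ.* + suc k) (ι (altrun (Φ σ))) i ∎

  hist-udrun-insertions : ∀ n {σ} → σ ∈ permutations (suc n) →
    hist (map udrun (insertions (suc (suc n) ∷ []) σ)) ≗ Λ 1ℤ (+ suc n) (ι (udrun σ))
  hist-udrun-insertions n {[]}    σ∈ = ⊥-elim (ℕ.0≢1+n (permutations-length (suc n) σ∈))
  hist-udrun-insertions n {b ∷ σ} σ∈ i with permutations-range (suc n) σ∈
  ... | (0<b , _) ∷ _ = begin
    hist (map udrun (insertions (suc (suc n) ∷ []) (b ∷ σ))) i
      ≡⟨ SingleInsertion.hist-udrun (suc (suc n)) b σ 0<b (All.map proj₂ (permutations-range (suc n) σ∈))
                                    (distinct-permutation (suc n) σ∈) i ⟩
    Λ 1ℤ (+ length (b ∷ σ)) (ι (udrun (b ∷ σ))) i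
      ≡⟨ cong (λ l → Λ 1ℤ (+ l) (ι (udrun (b ∷ σ))) i) (permutations-length (suc n) σ∈) ⟩
    Λ 1ℤ (+ suc n) (ι (udrun (b ∷ σ))) i ∎

  Fseries-step : ∀ k → Fseries (suc k) ≗ Λ 1ℤ (+ 2 ℤ.* + k) (Fseries k)
  Fseries-step zero    m = trans (Fseries-1 m) (x-Λ m)
  Fseries-step (suc k) m = begin
    Fseries (suc (suc k)) m
      ≡⟨ Fseries-hist (suc k) m ⟩
    hist (map (altrun ∘ Φ) (concatMap (insertions block) (stirling (suc k)))) m
      ≡⟨ cong (λ l → hist l m) (List.map-concatMap (altrun ∘ Φ) (insertions block) (stirling (suc k))) ⟩
    hist (concatMap (map (altrun ∘ Φ) ∘ insertions block) (stirling (suc k))) m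
      ≡⟨ hist-concatMap 1ℤ (+ 2 ℤ.* + suc k) (map (altrun ∘ Φ) ∘ insertions block) (altrun ∘ Φ) (stirling (suc k))
                        (hist-Φ-insertions k) m ⟩
    Λ 1ℤ (+ 2 ℤ.* + suc k) (hist (map (altrun ∘ Φ) (stirling (suc k)))) m
      ≡⟨ Λ-cong 1ℤ (+ 2 ℤ.* + suc k) (Fseries-hist k) m ⟨
    Λ 1ℤ (+ 2 ℤ.* + suc k) (Fseries (suc k)) m ∎
    where
    block = suc (suc k) ∷ suc (suc k) ∷ []

  Tseries-step : ∀ n → Tseries (suc n) ≗ Λ 1ℤ (+ n) (Tseries n)
  Tseries-step zero    m = trans (Tseries-1 m) (x-Λ m)
  Tseries-step (suc n) m = begin
    Tseries (suc (suc n)) m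
      ≡⟨ Tseries-hist (suc n) m ⟩
    hist (map udrun (concatMap (insertions block) (permutations (suc n)))) m
      ≡⟨ cong (λ l → hist l m) (List.map-concatMap udrun (insertions block) (permutations (suc n))) ⟩
    hist (concatMap (map udrun ∘ insertions block) (permutations (suc n))) m
      ≡⟨ hist-concatMap 1ℤ (+ suc n) (map udrun ∘ insertions block) udrun (permutations (suc n))
                        (hist-udrun-insertions n) m ⟩
    Λ 1ℤ (+ suc n) (hist (map udrun (permutations (suc n)))) m
      ≡⟨ Λ-cong 1ℤ (+ suc n) (Tseries-hist n) m ⟨
    Λ 1ℤ (+ suc n) (Tseries (suc n)) m ∎
    where
    block = suc (suc n) ∷ []

open Polynomials using (series; series-1; series-lhsCoeff; series-rhsCoeff)
open Recurrences using (egfSquare; substituted; egfSquare≗substituted)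
open Counting using (Fseries; Tseries; Fseries-step; Tseries-step; Tseries-degree)
open import Data.Integer.Properties using (+-injective)
open import Relation.Binary.PropositionalEquality using (refl; module ≡-Reasoning)
open ≡-Reasoning

mainTheorem12 : (n d : ℕ) → coeff (lhsCoeff n) d ≡ coeff (rhsCoeff n) d
mainTheorem12 n d = +-injective (begin
  series (lhsCoeff n) d
    ≡⟨ series-lhsCoeff n d ⟩
  egfSquare Fseries n d
    ≡⟨ egfSquare≗substituted Fseries Tseries series-1 Fseries-step refl Tseries-step Tseries-degree n d ⟩
  substituted Tseries n d
    ≡⟨ series-rhsCoeff n d ⟨
  series (rhsCoeff n) d ∎)
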